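{- Let $(G_n)_{n\in\mathbb{N}}$ be an arbitrary family of $3$-regular connected undirected graphs, and for each $n$ let $\Gamma_n$ be the group of edge flips of $G_n$. There is a polynomial $p$ such that for every $n\in\mathbb{N}$ and every choice of $u_n\in V(G_n)$, there exists a $\Gamma_n$-symmetric IPS refutation over $\mathbb{F}_2$ of the unsatisfiable system $\mathrm{CFI}(G_n,u_n,1)$ which is not $\vec y$-linear and has size at most $p(|\mathrm{CFI}(G_n,u_n,1)|)$.
   Context: CFI equations: for a $3$-regular connected undirected graph $G=(V,E)$, a vertex $u\in V$ and $a\in\{0,1\}$, $\mathrm{CFI}(G,u,a)$ is the system over $\mathbb{F}_2$ with variables $X=\{x^e_i: e\in E, i\in\mathbb{F}_2\}$ and polynomials: $x^e_i+x^f_j+x^g_k-(i+j+k)$ for every $v\in V\setminus\{u\}$ with $\{e,f,g\}=E(v)$ (the edges incident to $v$) and every $i,j,k\in\mathbb{F}_2$; $x^e_i+x^f_j+x^g_k-(i+j+k+a)$ for $\{e,f,g\}=E(u)$ and every $i,j,k\in\mathbb{F}_2$; $x^e_0+x^e_1-1$ for every $e\in E$; and $x^2-x$ for every $x\in X$. It is unsatisfiable iff $a=1$. Its size is the number of polynomials plus $|X|$. The edge-flip group $\Gamma$ is the subgroup of $(\mathbb{F}_2^{E},+)$ of all vectors $\pi$ with $\sum_{e\in E(v)}\pi_e=0$ for every $v\in V$, acting on $X$ by $\pi(x^e_i)=x^e_{i+\pi_e}$; $\mathrm{CFI}(G,u,a)$ is $\Gamma$-invariant. An algebraic circuit over variables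 $Z$ and field $\mathbb{F}$ is a connected DAG with input gates labelled by elements of $Z\cup\mathbb{F}$ and internal gates labelled $+$ or $\times$ (arbitrary fan-in), single output, computing a polynomial. It is $\Gamma$-symmetric (for $\Gamma$ acting on $Z$, trivially on $\mathbb{F}$) if each $\pi\in\Gamma$ extends to a DAG automorphism preserving internal labels and mapping each input gate labelled $z$ to one labelled $\pi(z)$. IPS: for $\mathcal{F}=\{f_1,\dots,f_m\}$ and fresh $Y=\{y_1,\dots,y_m\}$, an IPS certificate is $C(\vec x,\vec y)$ with $C(\vec x,\vec 0)=0$, $C(\vec x,f_1,\dots,f_m)=1$; an IPS refutation is a circuit over $X\uplus Y$ computing one; its size is $\max(\text{number of gates},|X|+|Y|)$; it is $\vec y$-linear if the certificate is $\sum_iy_ig_i(\vec x)$. For $\Gamma$-invariant $\mathcal{F}$, $\Gamma$ acts on $Y$ by $\pi(y_i)=y_j$ where $\pi(f_i)=f_j$; a $\Gamma$-symmetric IPS refutation is one that is a $\Gamma$-symmetric circuit w.r.t. this action on $X\uplus Y$. -}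

module Defs where

open import Data.Bool using (Bool; true; false; _xor_; _∧_; if_then_else_)
open import Data.Nat using (ℕ; zero; suc; _+_; _*_; _^_; _⊔_; _≤_)
open import Data.Fin using (Fin; _≟_) renaming (_<_ to _<ᶠ_)
import Data.Fin as F
open import Data.Product using (Σ; Σ-syntax; ∃; _×_; _,_; proj₁; proj₂)
open import Data.Sum using (_⊎_; inj₁; inj₂)
open import Data.List using (List; []; _∷_; foldr; map; filterᵇ; allFin)
open import Relation.Binary.PropositionalEquality using (_≡_; _≢_)
open import Relation.Nullary using (¬_; does)

-- The field F₂ is represented by Bool: addition = xor, multiplication = ∧.
-- In characteristic 2, subtraction coincides with addition.

F₂ : Set
F₂ = Bool

-- The quotient of Poly Z by _≈_ is
-- exactly the polynomial ring F₂[Z]; "p ≈ q" means equality of polynomials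
-- (NOT equality of the induced functions on F₂).

infixl 6 _⊕_
infixl 7 _⊗_

data Poly (Z : Set) : Set where
  var : Z → Poly Z
  cst : F₂ → Poly Z
  _⊕_ : Poly Z → Poly Z → Poly Z
  _⊗_ : Poly Z → Poly Z → Poly Z

infix 4 _≈_

data _≈_ {Z : Set} : Poly Z → Poly Z → Set where
  ≈-refl    : ∀ {p} → p ≈ p
  ≈-sym     : ∀ {p q} → p ≈ q → q ≈ p
  ≈-trans   : ∀ {p q r} → p ≈ q → q ≈ r → p ≈ r
  ⊕-cong    : ∀ {p p' q q'} → p ≈ p' → q ≈ q' → p ⊕ q ≈ p' ⊕ q'
  ⊗-cong    : ∀ {p p' q q'} → p ≈ p' → q ≈ q' → p ⊗ q ≈ p' ⊗ q'
  ⊕-assoc   : ∀ p q r → (p ⊕ q) ⊕ r ≈ p ⊕ (q ⊕ r)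
  ⊕-comm    : ∀ p q → p ⊕ q ≈ q ⊕ p
  ⊕-identity : ∀ p → cst false ⊕ p ≈ p
  ⊕-self    : ∀ p → p ⊕ p ≈ cst false
  ⊗-assoc   : ∀ p q r → (p ⊗ q) ⊗ r ≈ p ⊗ (q ⊗ r)
  ⊗-comm    : ∀ p q → p ⊗ q ≈ q ⊗ p
  ⊗-identity : ∀ p → cst true ⊗ p ≈ p
  distrib   : ∀ p q r → p ⊗ (q ⊕ r) ≈ p ⊗ q ⊕ p ⊗ r
  cst-⊕     : ∀ a b → cst a ⊕ cst b ≈ cst (a xor b)
  cst-⊗     : ∀ a b → cst a ⊗ cst b ≈ cst (a ∧ b)

substP : {Z W : Set} → (Z → Poly W) → Poly Z → Poly W
substP σ (var z) = σ z
substP σ (cst c) = cst c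
substP σ (p ⊕ q) = substP σ p ⊕ substP σ q
substP σ (p ⊗ q) = substP σ p ⊗ substP σ q

sumP : {Z : Set} → List (Poly Z) → Poly Z
sumP = foldr _⊕_ (cst false)

prodP : {Z : Set} → List (Poly Z) → Poly Z
prodP = foldr _⊗_ (cst true)

-- Gates are Fin size; wire h g ≡ true means there is an edge from h into g
-- (h is an input/child of g).  Gates are numbered topologically (every
-- wire goes from a smaller to a larger gate), which makes the graph a DAG.
-- Every gate has a directed path to the output gate (single output; this
-- also implies connectivity of the DAG).

data Gate (Z : Set) : Set where
  inp   : Z → Gate Z
  const : F₂ → Gate Z
  plus  : Gate Z
  times : Gate Z

IsInternal : {Z : Set} → Gate Z → Set
IsInternal (inp _)   = false ≡ true
IsInternal (const _) = false ≡ true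
IsInternal plus      = true ≡ true
IsInternal times     = true ≡ true

data Path {N : ℕ} (wire : Fin N → Fin N → Bool) : Fin N → Fin N → Set where
  here  : ∀ {g} → Path wire g g
  there : ∀ {g h o} → wire g h ≡ true → Path wire h o → Path wire g o

record Circuit (Z : Set) : Set where
  field
    gates   : ℕ
    label   : Fin gates → Gate Z
    wire    : Fin gates → Fin gates → Bool
    output  : Fin gates
    topological : ∀ h g → wire h g ≡ true → h <ᶠ g
    leaves-are-inputs : ∀ h g → wire h g ≡ true → IsInternal (label g)
    reaches-output : ∀ g → Path wire g output

  children : Fin gates → List (Fin gates)
  children g = filterᵇ (λ h → wire h g) (allFin gates)

GateValue : {Z : Set} → Gate Z → List (Poly Z) → Poly Z
GateValue (inp z)   _  = var z
GateValue (const c) _  = cst c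
GateValue plus      ps = sumP ps
GateValue times     ps = prodP ps

-- val is the (unique, by acyclicity) assignment of polynomials to gates
-- computed by the circuit.
Evaluation : {Z : Set} → Circuit Z → Set
Evaluation {Z} C = Σ[ val ∈ (Fin gates → Poly Z) ]
    (∀ g → val g ≡ GateValue (label g) (map val (children g)))
  where open Circuit C

computed : {Z : Set} (C : Circuit Z) → Evaluation C → Poly Z
computed C (val , _) = val (Circuit.output C)

mapGate : {Z : Set} → (Z → Z) → Gate Z → Gate Z
mapGate f (inp z)   = inp (f z)
mapGate f (const c) = const c
mapGate f plus      = plus
mapGate f times     = times

-- Symmetry w.r.t. a group (given as a carrier Grp with an action on Z;
-- the group acts trivially on F₂): every group element extends to an
-- automorphism of the DAG preserving internal labels and mapping an input
-- gate labelled z to one labelled (act π z).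
Symmetric : {Z : Set} (Grp : Set) (act : Grp → Z → Z) → Circuit Z → Set
Symmetric Grp act C =
  ∀ (π : Grp) → Σ[ σ ∈ (Fin gates → Fin gates) ] Σ[ σ⁻¹ ∈ (Fin gates → Fin gates) ]
      (∀ g → σ⁻¹ (σ g) ≡ g) × (∀ g → σ (σ⁻¹ g) ≡ g)
    × (∀ h g → wire (σ h) (σ g) ≡ wire h g)
    × (∀ g → label (σ g) ≡ mapGate (act π) (label g))
  where open Circuit C

-- IPS over F₂.  Axioms are indexed by a type Y, f : Y → Poly X; the
-- placeholder variables are y ∈ Y.

IsIPSCertificate : {X Y : Set} → (Y → Poly X) → Poly (X ⊎ Y) → Set
IsIPSCertificate {X} {Y} f C =
    substP zeroY C ≈ cst false
  × substP axY C ≈ cst true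
  where
    zeroY : X ⊎ Y → Poly X
    zeroY (inj₁ x) = var x
    zeroY (inj₂ y) = cst false
    axY : X ⊎ Y → Poly X
    axY (inj₁ x) = var x
    axY (inj₂ y) = f y

yLinear : {X Y : Set} → Poly (X ⊎ Y) → Set
yLinear {X} {Y} C =
  Σ[ L ∈ List (Y × Poly X) ]
    C ≈ sumP (map (λ { (y , g) → var (inj₂ y) ⊗ substP (λ x → var (inj₁ x)) g }) L)

-- Vertices Fin nV, edges Fin nE,
-- edge e has endpoints src e, tgt e (orientation irrelevant).
-- inc v enumerates, without repetition, exactly the edges incident to v,
-- i.e. E(v) = { inc v 0 , inc v 1 , inc v 2 }.

record CubicGraph : Set where
  field
    nV nE : ℕ
    src tgt : Fin nE → Fin nV
    loopless : ∀ e → src e ≢ tgt e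
    simple : ∀ e e' → ((src e ≡ src e' × tgt e ≡ tgt e') ⊎ (src e ≡ tgt e' × tgt e ≡ src e'))
                    → e ≡ e'
    inc : Fin nV → Fin 3 → Fin nE
    inc-injective : ∀ v k l → inc v k ≡ inc v l → k ≡ l
    inc-incident : ∀ v k → (src (inc v k) ≡ v) ⊎ (tgt (inc v k) ≡ v)
    inc-complete : ∀ v e → (src e ≡ v) ⊎ (tgt e ≡ v) → ∃ λ k → inc v k ≡ e

open CubicGraph public

Adjacent : (G : CubicGraph) → Fin (nV G) → Fin (nV G) → Set
Adjacent G v w = ∃ λ e → (src G e ≡ v × tgt G e ≡ w) ⊎ (src G e ≡ w × tgt G e ≡ v)

data Walk (G : CubicGraph) : Fin (nV G) → Fin (nV G) → Set where
  stay : ∀ {v} → Walk G v v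
  step : ∀ {v w x} → Adjacent G v w → Walk G w x → Walk G v x

Connected : CubicGraph → Set
Connected G = ∀ v w → Walk G v w

Var : CubicGraph → Set
Var G = Fin (nE G) × F₂

data Ax (G : CubicGraph) : Set where
  vax : Fin (nV G) → F₂ → F₂ → F₂ → Ax G
  eax : Fin (nE G) → Ax G
  bax : Fin (nE G) → F₂ → Ax G

CFI : (G : CubicGraph) → Fin (nV G) → F₂ → Ax G → Poly (Var G)
CFI G u a (vax v i j k) =
  x (inc G v F.zero) i ⊕ x (inc G v (F.suc F.zero)) j ⊕ x (inc G v (F.suc (F.suc F.zero))) k
    ⊕ cst (i xor j xor k xor (if does (v ≟ u) then a else false))
  where x : Fin (nE G) → F₂ → Poly (Var G)
        x e b = var (e , b)
CFI G u a (eax e) = var (e , false) ⊕ var (e , true) ⊕ cst true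
CFI G u a (bax e i) = var (e , i) ⊗ var (e , i) ⊕ var (e , i)

numVars : CubicGraph → ℕ
numVars G = 2 * nE G

-- number of polynomials = 8|V| + |E| + |X|  (= number of elements of Ax G)
numAxioms : CubicGraph → ℕ
numAxioms G = 8 * nV G + nE G + 2 * nE G

-- |CFI(G,u,a)| = number of polynomials + |X|
cfiSize : CubicGraph → ℕ
cfiSize G = numAxioms G + numVars G

EdgeFlip : CubicGraph → Set
EdgeFlip G = Σ[ π ∈ (Fin (nE G) → F₂) ]
  (∀ v → π (inc G v F.zero) xor π (inc G v (F.suc F.zero)) xor π (inc G v (F.suc (F.suc F.zero))) ≡ false)

actVar : (G : CubicGraph) → EdgeFlip G → Var G → Var G
actVar G (π , _) (e , i) = (e , i xor π e)

actAx : (G : CubicGraph) → EdgeFlip G → Ax G → Ax G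
actAx G (π , _) (vax v i j k) =
  vax v (i xor π (inc G v F.zero)) (j xor π (inc G v (F.suc F.zero)))
        (k xor π (inc G v (F.suc (F.suc F.zero))))
actAx G (π , _) (eax e) = eax e
actAx G (π , _) (bax e i) = bax e (i xor π e)

actXY : (G : CubicGraph) → EdgeFlip G → Var G ⊎ Ax G → Var G ⊎ Ax G
actXY G π (inj₁ x) = inj₁ (actVar G π x)
actXY G π (inj₂ y) = inj₂ (actAx G π y)

record SymIPSRefutation (G : CubicGraph) (u : Fin (nV G)) (a : F₂) : Set where
  field
    circuit    : Circuit (Var G ⊎ Ax G)
    evaluation : Evaluation circuit
    certificate : IsIPSCertificate (CFI G u a) (computed circuit evaluation)
    symmetric  : Symmetric (EdgeFlip G) (actXY G) circuit

  size : ℕ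
  size = Circuit.gates circuit ⊔ (numVars G + numAxioms G)

  isYLinear : Set
  isYLinear = yLinear {Var G} {Ax G} (computed circuit evaluation)

-- polynomials with natural coefficients (coefficient list, lowest first)

NatPoly : Set
NatPoly = List ℕ

evalNatPoly : NatPoly → ℕ → ℕ
evalNatPoly []       n = 0
evalNatPoly (c ∷ cs) n = c + n * evalNatPoly cs n

-- Write e₀, e₁, e₂ for the edges at a vertex v, s_e = x^e_0 + x^e_1, S_e = y_e + 1 and M_v = ∏_{e ∉ E(v)} S_e.
-- The certificate is
--   C = 1 + Σ_{v,i,j} x^{e₀}_i x^{e₁}_j x^{e₂}_{i+j} (1 + M_v) + Σ_{v,i,j} x^{e₀}_i x^{e₁}_j y_{v,i,j,i+j}
--         + Σ_v S_{e₀} S_{e₁} (S_{e₀} + S_{e₁} + [v = u]).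
-- At y = 0 every S_e and M_v is 1, so C = 1 + Σ_v [v = u] = 0.  At y = the axioms S_e = s_e, and at each
-- vertex the y-terms and the S-terms cancel the cubic terms by a polynomial identity; what is left,
-- Σ_v M_v Σ_{i,j} x^{e₀}_i x^{e₁}_j x^{e₂}_{i+j} = Σ_v Σ_k x^{e_k}_0 ∏_{e ≠ e_k} s_e, counts every edge once from
-- each endpoint, so C = 1.  Evaluating at y_e = 1 + ε in the dual numbers (all other variables 0) sends every
-- y-linear polynomial to the line F₂(1 + ε) but C to 1, so C is not y-linear.  Every term of C is a gate
-- indexed by (v, i, j), an edge flip π moves these gates by (i, j) ↦ (i + π e₀, j + π e₁), and the circuit
-- has 19|V| + 4|E| + 4 gates.

module Submission where

open import Defs

open import Algebra.Bundles using (CommutativeMonoid; CommutativeRing)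
import Algebra.Solver.Ring
open import Algebra.Solver.Ring.AlmostCommutativeRing using (AlmostCommutativeRing; _-Raw-AlmostCommutative⟶_)
open import Data.Bool using (Bool; true; false; _xor_; _∧_; _∨_; not; if_then_else_)
open import Data.Bool.Properties
  using (xor-∧-commutativeRing; xor-assoc; xor-comm; xor-same; xor-identityʳ; ∧-comm; ∧-zeroʳ)
  renaming (_≟_ to _≟ᵇ_)
open import Data.Bool.Solver using (module xor-∧-Solver)
open import Data.Empty using (⊥; ⊥-elim)
open import Data.Fin using (Fin; toℕ; _↑ˡ_; _↑ʳ_; combine; remQuot; splitAt) renaming (zero to fzero; suc to fsuc)
open import Data.Fin.Properties
  using (_≟_; toℕ-↑ˡ; toℕ-↑ʳ; toℕ<n; remQuot-combine; combine-remQuot)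
  using (splitAt-↑ˡ; splitAt-↑ʳ; splitAt⁻¹-↑ˡ; splitAt⁻¹-↑ʳ)
open import Data.List using (List; []; _∷_; map; foldr; tabulate; filterᵇ; allFin)
open import Data.List.Properties using (map-tabulate; map-∘)
open import Data.List.Membership.Propositional using (_∈_)
open import Data.List.Membership.Propositional.Properties using (∈-tabulate⁺; ∈-map⁺; ∈-map⁻)
open import Data.List.Relation.Binary.Subset.Propositional using (_⊆_)
open import Data.List.Relation.Binary.Subset.Propositional.Properties using (⊆-reflexive)
import Data.List.Relation.Unary.All as All
import Data.List.Relation.Unary.All.Properties as All
open import Data.List.Relation.Unary.All using (All; []; _∷_)
open import Data.List.Relation.Unary.AllPairs using ([]; _∷_)
open import Data.List.Relation.Unary.Any using (any?; here; there)
open import Data.List.Relation.Unary.Unique.Propositional using (Unique)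
open import Data.List.Relation.Unary.Unique.Propositional.Properties using (tabulate⁺; map⁺; filter⁺; allFin⁺)
open import Data.Maybe using (Maybe; just; nothing)
open import Data.Nat using (ℕ; zero; suc; _+_; _*_; _<_; _≤_; s≤s)
open import Data.Nat.Properties using (<-≤-trans; m≤m+n; +-monoʳ-<; n<1+n; ⊔-lub)
open import Data.Nat.Solver using (module +-*-Solver)
open import Data.Product using (Σ-syntax; _×_; _,_; proj₁; proj₂)
import Data.Product as Product
open import Data.Sum using (_⊎_; inj₁; inj₂)
import Data.Sum as Sum
open import Data.Unit using (⊤; tt)
open import Function using (_∘_)
open import Function.Bundles using (mk⇔)
open import Relation.Binary.Construct.Closure.ReflexiveTransitive using (Star; _◅_) renaming (ε to stop)
open import Relation.Binary.Definitions using (DecidableEquality)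
open import Relation.Binary.PropositionalEquality
  using (_≡_; _≢_; refl; sym; trans; cong; cong₂; subst; subst₂)
import Relation.Binary.PropositionalEquality as ≡
open import Relation.Nullary using (Dec; yes; no; does; ¬_; T?)
import Relation.Nullary.Decidable as Dec

-- Polynomials over F₂

module PolyRing (Z : Set) where

  ≈-reflexive : {p q : Poly Z} → p ≡ q → p ≈ q
  ≈-reflexive refl = ≈-refl

  ⊕-identityʳ : (p : Poly Z) → p ⊕ cst false ≈ p
  ⊕-identityʳ p = ≈-trans (⊕-comm p _) (⊕-identity p)

  ⊗-identityʳ : (p : Poly Z) → p ⊗ cst true ≈ p
  ⊗-identityʳ p = ≈-trans (⊗-comm p _) (⊗-identity p)

  distribʳ : (p q r : Poly Z) → (q ⊕ r) ⊗ p ≈ q ⊗ p ⊕ r ⊗ p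
  distribʳ p q r = ≈-trans (⊗-comm _ p) (≈-trans (distrib p q r) (⊕-cong (⊗-comm p q) (⊗-comm p r)))

  ⊗-zeroʳ : (p : Poly Z) → p ⊗ cst false ≈ cst false
  ⊗-zeroʳ p = ≈-trans (⊗-cong ≈-refl (≈-sym (⊕-identity _)))
                      (≈-trans (distrib p _ _) (⊕-self _))

  ⊗-zeroˡ : (p : Poly Z) → cst false ⊗ p ≈ cst false
  ⊗-zeroˡ p = ≈-trans (⊗-comm _ p) (⊗-zeroʳ p)

  prodP-absorb : {B : Set} {f : B → Poly Z} {b : B} {bs : List B} → b ∈ bs → f b ≈ cst false →
                 prodP (map f bs) ≈ cst false
  prodP-absorb (here refl) fb≈0 = ≈-trans (⊗-cong fb≈0 ≈-refl) (⊗-zeroˡ _)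
  prodP-absorb (there b∈)  fb≈0 = ≈-trans (⊗-cong ≈-refl (prodP-absorb b∈ fb≈0)) (⊗-zeroʳ _)

  -- Characteristic 2: negation is the identity.
  ring : AlmostCommutativeRing _ _
  ring = record
    { Carrier = Poly Z ; _≈_ = _≈_ ; _+_ = _⊕_ ; _*_ = _⊗_ ; -_ = λ p → p
    ; 0# = cst false ; 1# = cst true
    ; isAlmostCommutativeRing = record
      { isCommutativeSemiring = record
        { isSemiring = record
          { isSemiringWithoutAnnihilatingZero = record
            { +-isCommutativeMonoid = record
              { isMonoid = record
                { isSemigroup = record
                  { isMagma = record
                    { isEquivalence = record { refl = ≈-refl ; sym = ≈-sym ; trans = ≈-trans }
                    ; ∙-cong = ⊕-cong }
                  ; assoc = ⊕-assoc }
                ; identity = ⊕-identity , ⊕-identityʳ }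
              ; comm = ⊕-comm }
            ; *-cong = ⊗-cong
            ; *-assoc = ⊗-assoc
            ; *-identity = ⊗-identity , ⊗-identityʳ
            ; distrib = distrib , distribʳ }
          ; zero = ⊗-zeroˡ , ⊗-zeroʳ }
        ; *-comm = ⊗-comm }
      ; -‿cong = λ p → p
      ; -‿*-distribˡ = λ _ _ → ≈-refl
      ; -‿+-comm = λ _ _ → ≈-refl } }

  open AlmostCommutativeRing ring public
    using (setoid; +-commutativeMonoid; *-commutativeMonoid)

  constant : CommutativeRing.rawRing xor-∧-commutativeRing -Raw-AlmostCommutative⟶ ring
  constant = record
    { ⟦_⟧ = cst ; +-homo = λ a b → ≈-sym (cst-⊕ a b) ; *-homo = λ a b → ≈-sym (cst-⊗ a b)
    ; -‿homo = λ _ → ≈-refl ; 0-homo = ≈-refl ; 1-homo = ≈-refl }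

  constant-≟ : (a b : Bool) → Maybe (cst {Z} a ≈ cst b)
  constant-≟ a b with a ≟ᵇ b
  ... | yes refl = just ≈-refl
  ... | no _     = nothing

  module Solver =
    Algebra.Solver.Ring (CommutativeRing.rawRing xor-∧-commutativeRing) ring constant constant-≟

substP-cong : {Z W : Set} (σ : Z → Poly W) {p q : Poly Z} → p ≈ q → substP σ p ≈ substP σ q
substP-cong σ ≈-refl            = ≈-refl
substP-cong σ (≈-sym e)         = ≈-sym (substP-cong σ e)
substP-cong σ (≈-trans e e′)    = ≈-trans (substP-cong σ e) (substP-cong σ e′)
substP-cong σ (⊕-cong e e′)     = ⊕-cong (substP-cong σ e) (substP-cong σ e′)
substP-cong σ (⊗-cong e e′)     = ⊗-cong (substP-cong σ e) (substP-cong σ e′)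
substP-cong σ (⊕-assoc p q r)   = ⊕-assoc _ _ _
substP-cong σ (⊕-comm p q)      = ⊕-comm _ _
substP-cong σ (⊕-identity p)    = ⊕-identity _
substP-cong σ (⊕-self p)        = ⊕-self _
substP-cong σ (⊗-assoc p q r)   = ⊗-assoc _ _ _
substP-cong σ (⊗-comm p q)      = ⊗-comm _ _
substP-cong σ (⊗-identity p)    = ⊗-identity _
substP-cong σ (distrib p q r)   = distrib _ _ _
substP-cong σ (cst-⊕ a b)       = cst-⊕ a b
substP-cong σ (cst-⊗ a b)       = cst-⊗ a b

substP-ext : {Z W : Set} {σ τ : Z → Poly W} → (∀ z → σ z ≡ τ z) → (p : Poly Z) →
             substP σ p ≡ substP τ p
substP-ext eq (var z) = eq z
substP-ext eq (cst b) = refl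
substP-ext eq (p ⊕ q) = cong₂ _⊕_ (substP-ext eq p) (substP-ext eq q)
substP-ext eq (p ⊗ q) = cong₂ _⊗_ (substP-ext eq p) (substP-ext eq q)

-- Finite types and sums

infixr 7 _u×_
infixr 6 _u+_

data U : Set where
  uF : ℕ → U
  uB u1 : U
  _u×_ _u+_ : U → U → U

El : U → Set
El (uF n)   = Fin n
El uB       = Bool
El u1       = ⊤
El (c u× d) = El c × El d
El (c u+ d) = El c ⊎ El d

size : U → ℕ
size (uF n)   = n
size uB       = 2
size u1       = 1
size (c u× d) = size c * size d
size (c u+ d) = size c + size d

enc : (c : U) → El c → Fin (size c)
enc (uF n)   a        = a
enc uB       false    = fzero
enc uB       true     = fsuc fzero
enc u1       tt       = fzero
enc (c u× d) (a , b)  = combine (enc c a) (enc d b)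
enc (c u+ d) (inj₁ a) = enc c a ↑ˡ size d
enc (c u+ d) (inj₂ b) = size c ↑ʳ enc d b

dec : (c : U) → Fin (size c) → El c
dec (uF n)   i        = i
dec uB       fzero    = false
dec uB       (fsuc _) = true
dec u1       _        = tt
dec (c u× d) i        = Product.map (dec c) (dec d) (remQuot (size d) i)
dec (c u+ d) i        = Sum.map (dec c) (dec d) (splitAt (size c) i)

dec-enc : (c : U) (a : El c) → dec c (enc c a) ≡ a
dec-enc (uF n)   a        = refl
dec-enc uB       false    = refl
dec-enc uB       true     = refl
dec-enc u1       tt       = refl
dec-enc (c u× d) (a , b)  =
  trans (cong (Product.map (dec c) (dec d)) (remQuot-combine (enc c a) (enc d b)))
        (cong₂ _,_ (dec-enc c a) (dec-enc d b))
dec-enc (c u+ d) (inj₁ a) =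
  trans (cong (Sum.map (dec c) (dec d)) (splitAt-↑ˡ (size c) (enc c a) (size d))) (cong inj₁ (dec-enc c a))
dec-enc (c u+ d) (inj₂ b) =
  trans (cong (Sum.map (dec c) (dec d)) (splitAt-↑ʳ (size c) (size d) (enc d b))) (cong inj₂ (dec-enc d b))

enc-dec : (c : U) (i : Fin (size c)) → enc c (dec c i) ≡ i
enc-dec (uF n)   i               = refl
enc-dec uB       fzero           = refl
enc-dec uB       (fsuc fzero)    = refl
enc-dec u1       fzero           = refl
enc-dec (c u× d) i               =
  trans (cong₂ combine (enc-dec c _) (enc-dec d _)) (combine-remQuot {size c} (size d) i)
enc-dec (c u+ d) i with splitAt (size c) i in eq
... | inj₁ a = trans (cong (_↑ˡ size d) (enc-dec c a)) (splitAt⁻¹-↑ˡ eq)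
... | inj₂ b = trans (cong (size c ↑ʳ_) (enc-dec d b)) (splitAt⁻¹-↑ʳ eq)

enc-injective : (c : U) {a b : El c} → enc c a ≡ enc c b → a ≡ b
enc-injective c {a} {b} eq = trans (sym (dec-enc c a)) (trans (cong (dec c) eq) (dec-enc c b))

dec-injective : (c : U) {i j : Fin (size c)} → dec c i ≡ dec c j → i ≡ j
dec-injective c {i} {j} eq = trans (sym (enc-dec c i)) (trans (cong (enc c) eq) (enc-dec c j))

decEq : (c : U) → DecidableEquality (El c)
decEq c a b = Dec.map′ (enc-injective c) (cong (enc c)) (enc c a ≟ enc c b)

member? : (c : U) (a : El c) (xs : List (El c)) → Dec (a ∈ xs)
member? c a = any? (decEq c a)

elements : (c : U) → List (El c)
elements c = tabulate (dec c)

elements-complete : (c : U) (a : El c) → a ∈ elements c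
elements-complete c a = subst (_∈ elements c) (dec-enc c a) (∈-tabulate⁺ (enc c a))

elements-unique : (c : U) → Unique (elements c)
elements-unique c = tabulate⁺ (dec-injective c)

image-closed : (d : U) {B : Set} (t : El d → B) (σ : B → B) (τ : El d → El d) →
               (∀ b → σ (t b) ≡ t (τ b)) → map σ (map t (elements d)) ⊆ map t (elements d)
image-closed d t σ τ σt≡tτ x∈ with ∈-map⁻ σ x∈
... | y , y∈ , refl with ∈-map⁻ t y∈
...   | b , _ , refl = subst (_∈ _) (sym (σt≡tτ b)) (∈-map⁺ t (elements-complete d (τ b)))

Precedes : (c : U) → El c → El c → Set
Precedes (c u+ d) (inj₁ a) (inj₁ b) = Precedes c a b
Precedes (c u+ d) (inj₁ a) (inj₂ b) = ⊤
Precedes (c u+ d) (inj₂ a) (inj₁ b) = ⊥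
Precedes (c u+ d) (inj₂ a) (inj₂ b) = Precedes d a b
Precedes _        _        _        = ⊥

Precedes⇒enc< : (c : U) (a b : El c) → Precedes c a b → toℕ (enc c a) < toℕ (enc c b)
Precedes⇒enc< (c u+ d) (inj₁ a) (inj₁ b) p
  rewrite toℕ-↑ˡ (enc c a) (size d) | toℕ-↑ˡ (enc c b) (size d) = Precedes⇒enc< c a b p
Precedes⇒enc< (c u+ d) (inj₁ a) (inj₂ b) _
  rewrite toℕ-↑ˡ (enc c a) (size d) | toℕ-↑ʳ (size c) (enc d b) = <-≤-trans (toℕ<n (enc c a)) (m≤m+n _ _)
Precedes⇒enc< (c u+ d) (inj₂ a) (inj₂ b) p
  rewrite toℕ-↑ʳ (size c) (enc d a) | toℕ-↑ʳ (size c) (enc d b) = +-monoʳ-< (size c) (Precedes⇒enc< d a b p)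

module RawSums {a} {A : Set a} (_∙_ : A → A → A) (ε : A) where

  fold : List A → A
  fold = foldr _∙_ ε

  ΣF : (n : ℕ) → (Fin n → A) → A
  ΣF zero    f = ε
  ΣF (suc n) f = f fzero ∙ ΣF n (f ∘ fsuc)

  ΣU : (c : U) → (El c → A) → A
  ΣU (uF n)   f = ΣF n f
  ΣU uB       f = f false ∙ f true
  ΣU u1       f = f tt
  ΣU (c u× d) f = ΣU c (λ a → ΣU d (λ b → f (a , b)))
  ΣU (c u+ d) f = ΣU c (f ∘ inj₁) ∙ ΣU d (f ∘ inj₂)

  sel : Bool → A → A
  sel b x = if b then x else ε

  ΣF-cong-≗ : (n : ℕ) {f g : Fin n → A} → (∀ i → f i ≡ g i) → ΣF n f ≡ ΣF n g
  ΣF-cong-≗ zero    eq = refl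
  ΣF-cong-≗ (suc n) eq = cong₂ _∙_ (eq fzero) (ΣF-cong-≗ n (eq ∘ fsuc))

  ΣU-cong-≗ : (c : U) {f g : El c → A} → (∀ a → f a ≡ g a) → ΣU c f ≡ ΣU c g
  ΣU-cong-≗ (uF n)   eq = ΣF-cong-≗ n eq
  ΣU-cong-≗ uB       eq = cong₂ _∙_ (eq false) (eq true)
  ΣU-cong-≗ u1       eq = eq tt
  ΣU-cong-≗ (c u× d) eq = ΣU-cong-≗ c (λ a → ΣU-cong-≗ d (λ b → eq (a , b)))
  ΣU-cong-≗ (c u+ d) eq = cong₂ _∙_ (ΣU-cong-≗ c (eq ∘ inj₁)) (ΣU-cong-≗ d (eq ∘ inj₂))

  ΣU-ε-≡ : ε ∙ ε ≡ ε → (c : U) → ΣU c (λ _ → ε) ≡ ε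
  ΣU-ε-≡ ε∙ε (uF zero)    = refl
  ΣU-ε-≡ ε∙ε (uF (suc n)) = trans (cong (ε ∙_) (ΣU-ε-≡ ε∙ε (uF n))) ε∙ε
  ΣU-ε-≡ ε∙ε uB           = ε∙ε
  ΣU-ε-≡ ε∙ε u1           = refl
  ΣU-ε-≡ ε∙ε (c u× d)     = trans (ΣU-cong-≗ c (λ _ → ΣU-ε-≡ ε∙ε d)) (ΣU-ε-≡ ε∙ε c)
  ΣU-ε-≡ ε∙ε (c u+ d)     = trans (cong₂ _∙_ (ΣU-ε-≡ ε∙ε c) (ΣU-ε-≡ ε∙ε d)) ε∙ε

module _ {a b} {A : Set a} {B : Set b} {_∙_ : A → A → A} {ε : A} {_∙′_ : B → B → B} {ε′ : B}
         (h : A → B) (h-ε : h ε ≡ ε′) (h-∙ : ∀ x y → h (x ∙ y) ≡ h x ∙′ h y) where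
  private
    module S = RawSums _∙_ ε
    module T = RawSums _∙′_ ε′

  fold-homo : (xs : List A) → h (S.fold xs) ≡ T.fold (map h xs)
  fold-homo []       = h-ε
  fold-homo (x ∷ xs) = trans (h-∙ x _) (cong (h x ∙′_) (fold-homo xs))

  ΣF-homo : (n : ℕ) (f : Fin n → A) → h (S.ΣF n f) ≡ T.ΣF n (h ∘ f)
  ΣF-homo zero    f = h-ε
  ΣF-homo (suc n) f = trans (h-∙ _ _) (cong (h (f fzero) ∙′_) (ΣF-homo n (f ∘ fsuc)))

  ΣU-homo : (c : U) (f : El c → A) → h (S.ΣU c f) ≡ T.ΣU c (h ∘ f)
  ΣU-homo (uF n)   f = ΣF-homo n f
  ΣU-homo uB       f = h-∙ _ _
  ΣU-homo u1       f = refl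
  ΣU-homo (c u× d) f = trans (ΣU-homo c _) (T.ΣU-cong-≗ c (λ a → ΣU-homo d _))
  ΣU-homo (c u+ d) f = trans (h-∙ _ _) (cong₂ _∙′_ (ΣU-homo c (f ∘ inj₁)) (ΣU-homo d (f ∘ inj₂)))

does-exclusive : {P Q : Set} (p? : Dec P) (q? : Dec Q) → (P → Q → ⊥) → does p? ∧ does q? ≡ false
does-exclusive (yes p) (yes q) ¬pq = ⊥-elim (¬pq p q)
does-exclusive (yes _) (no _)  _   = refl
does-exclusive (no _)  _       _   = refl

module Sums {a ℓ} (M : CommutativeMonoid a ℓ) where
  open CommutativeMonoid M
    renaming (Carrier to A; _≈_ to _≃_; refl to ≃-refl; sym to ≃-sym; trans to ≃-trans; reflexive to ≃-reflexive)
  open RawSums _∙_ ε public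
  open import Algebra.Properties.CommutativeSemigroup commutativeSemigroup using (interchange)
  open import Relation.Binary.Reasoning.Setoid setoid

  ΣF-cong : (n : ℕ) {f g : Fin n → A} → (∀ i → f i ≃ g i) → ΣF n f ≃ ΣF n g
  ΣF-cong zero    eq = ≃-refl
  ΣF-cong (suc n) eq = ∙-cong (eq fzero) (ΣF-cong n (eq ∘ fsuc))

  ΣU-cong : (c : U) {f g : El c → A} → (∀ a → f a ≃ g a) → ΣU c f ≃ ΣU c g
  ΣU-cong (uF n)   eq = ΣF-cong n eq
  ΣU-cong uB       eq = ∙-cong (eq false) (eq true)
  ΣU-cong u1       eq = eq tt
  ΣU-cong (c u× d) eq = ΣU-cong c (λ a → ΣU-cong d (λ b → eq (a , b)))
  ΣU-cong (c u+ d) eq = ∙-cong (ΣU-cong c (eq ∘ inj₁)) (ΣU-cong d (eq ∘ inj₂))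

  ΣF-ε : (n : ℕ) → ΣF n (λ _ → ε) ≃ ε
  ΣF-ε zero    = ≃-refl
  ΣF-ε (suc n) = ≃-trans (∙-cong ≃-refl (ΣF-ε n)) (identityˡ ε)

  ΣU-ε : (c : U) → ΣU c (λ _ → ε) ≃ ε
  ΣU-ε (uF n)   = ΣF-ε n
  ΣU-ε uB       = identityˡ ε
  ΣU-ε u1       = ≃-refl
  ΣU-ε (c u× d) = ≃-trans (ΣU-cong c (λ _ → ΣU-ε d)) (ΣU-ε c)
  ΣU-ε (c u+ d) = ≃-trans (∙-cong (ΣU-ε c) (ΣU-ε d)) (identityˡ ε)

  ΣF-∙ : (n : ℕ) (f g : Fin n → A) → ΣF n (λ i → f i ∙ g i) ≃ ΣF n f ∙ ΣF n g
  ΣF-∙ zero    f g = ≃-sym (identityˡ ε)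
  ΣF-∙ (suc n) f g = ≃-trans (∙-cong ≃-refl (ΣF-∙ n (f ∘ fsuc) (g ∘ fsuc))) (interchange _ _ _ _)

  ΣU-∙ : (c : U) (f g : El c → A) → ΣU c (λ a → f a ∙ g a) ≃ ΣU c f ∙ ΣU c g
  ΣU-∙ (uF n)   f g = ΣF-∙ n f g
  ΣU-∙ uB       f g = interchange _ _ _ _
  ΣU-∙ u1       f g = ≃-refl
  ΣU-∙ (c u× d) f g = ≃-trans (ΣU-cong c (λ a → ΣU-∙ d _ _)) (ΣU-∙ c _ _)
  ΣU-∙ (c u+ d) f g = ≃-trans (∙-cong (ΣU-∙ c _ _) (ΣU-∙ d _ _)) (interchange _ _ _ _)

  ΣF-swap : (m n : ℕ) (f : Fin m → Fin n → A) →
            ΣF m (λ i → ΣF n (f i)) ≃ ΣF n (λ j → ΣF m (λ i → f i j))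
  ΣF-swap zero    n f = ≃-sym (ΣF-ε n)
  ΣF-swap (suc m) n f = ≃-trans (∙-cong ≃-refl (ΣF-swap m n (f ∘ fsuc))) (≃-sym (ΣF-∙ n _ _))

  ΣF-+ : (m n : ℕ) (f : Fin (m + n) → A) → ΣF (m + n) f ≃ ΣF m (f ∘ (_↑ˡ n)) ∙ ΣF n (f ∘ (m ↑ʳ_))
  ΣF-+ zero    n f = ≃-sym (identityˡ _)
  ΣF-+ (suc m) n f = ≃-trans (∙-cong ≃-refl (ΣF-+ m n (f ∘ fsuc))) (≃-sym (assoc _ _ _))

  ΣF-* : (m n : ℕ) (f : Fin (m * n) → A) → ΣF (m * n) f ≃ ΣF m (λ i → ΣF n (λ j → f (combine i j)))
  ΣF-* zero    n f = ≃-refl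
  ΣF-* (suc m) n f = ≃-trans (ΣF-+ n (m * n) f) (∙-cong ≃-refl (ΣF-* m n (f ∘ (n ↑ʳ_))))

  ΣF-size : (c : U) (f : Fin (size c) → A) → ΣF (size c) f ≃ ΣU c (f ∘ enc c)
  ΣF-size (uF n)   f = ≃-refl
  ΣF-size uB       f = ∙-cong ≃-refl (identityʳ _)
  ΣF-size u1       f = identityʳ _
  ΣF-size (c u× d) f = begin
    ΣF (size c * size d) f                                   ≈⟨ ΣF-* (size c) (size d) f ⟩
    ΣF (size c) (λ i → ΣF (size d) (λ j → f (combine i j))) ≈⟨ ΣF-cong (size c) (λ i → ΣF-size d _) ⟩
    ΣF (size c) (λ i → ΣU d (λ b → f (combine i (enc d b)))) ≈⟨ ΣF-size c _ ⟩
    ΣU (c u× d) (f ∘ enc (c u× d))                           ∎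
  ΣF-size (c u+ d) f = ≃-trans (ΣF-+ (size c) (size d) f) (∙-cong (ΣF-size c _) (ΣF-size d _))

  fold-tabulate : (n : ℕ) (f : Fin n → A) → fold (tabulate f) ≡ ΣF n f
  fold-tabulate zero    f = ≡.refl
  fold-tabulate (suc n) f = ≡.cong (f fzero ∙_) (fold-tabulate n (f ∘ fsuc))

  fold-elements : (c : U) (f : El c → A) → fold (map f (elements c)) ≃ ΣU c f
  fold-elements c f = begin
    fold (map f (tabulate (dec c)))  ≡⟨ ≡.cong fold (map-tabulate (dec c) f) ⟩
    fold (tabulate (f ∘ dec c))      ≡⟨ fold-tabulate (size c) (f ∘ dec c) ⟩
    ΣF (size c) (f ∘ dec c)          ≈⟨ ΣF-size c (f ∘ dec c) ⟩
    ΣU c (f ∘ dec c ∘ enc c)         ≡⟨ ΣU-cong-≗ c (λ a → ≡.cong f (dec-enc c a)) ⟩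
    ΣU c f                           ∎

  fold-map-cong : {B : Set} {f g : B → A} → (∀ x → f x ≃ g x) → (xs : List B) →
                  fold (map f xs) ≃ fold (map g xs)
  fold-map-cong eq []       = ≃-refl
  fold-map-cong eq (x ∷ xs) = ∙-cong (eq x) (fold-map-cong eq xs)

  fold-map-ε : {B : Set} {f : B → A} → (∀ x → f x ≃ ε) → (xs : List B) → fold (map f xs) ≃ ε
  fold-map-ε eq []       = ≃-refl
  fold-map-ε eq (x ∷ xs) = ≃-trans (∙-cong (eq x) (fold-map-ε eq xs)) (identityˡ ε)

  sel-∨ : (b b′ : Bool) (x : A) → b ∧ b′ ≡ false → sel (b ∨ b′) x ≃ sel b x ∙ sel b′ x
  sel-∨ false false x _ = ≃-sym (identityˡ ε)
  sel-∨ false true  x _ = ≃-sym (identityˡ x)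
  sel-∨ true  false x _ = ≃-sym (identityʳ x)

  ΣF-δ : (n : ℕ) (p : Fin n) (f : Fin n → A) → ΣF n (λ i → sel (does (i ≟ p)) (f i)) ≃ f p
  ΣF-δ (suc n) fzero    f = ≃-trans (∙-cong ≃-refl (ΣF-ε n)) (identityʳ _)
  ΣF-δ (suc n) (fsuc p) f = ≃-trans (identityˡ _) (ΣF-δ n p (f ∘ fsuc))

  filter-sum : {B : Set} (n : ℕ) (g : Fin n → B) (P : B → Bool) (f : B → A) →
               fold (map f (filterᵇ P (tabulate g))) ≃ ΣF n (λ i → sel (P (g i)) (f (g i)))
  filter-sum zero    g P f = ≃-refl
  filter-sum (suc n) g P f with P (g fzero)
  ... | true  = ∙-cong ≃-refl (filter-sum n (g ∘ fsuc) P f)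
  ... | false = ≃-trans (filter-sum n (g ∘ fsuc) P f) (≃-sym (identityˡ _))

  ΣF-sel-pair : (n : ℕ) (q r : Fin n) → q ≢ r → (P : Fin n → Bool) →
                (∀ i → P i ∧ (does (i ≟ q) ∨ does (i ≟ r)) ≡ false) → (f : Fin n → A) →
                ΣF n (λ i → sel (P i) (f i)) ∙ (f q ∙ f r) ≃
                ΣF n (λ i → sel (P i ∨ (does (i ≟ q) ∨ does (i ≟ r))) (f i))
  ΣF-sel-pair n q r q≢r P disjoint f = begin
    ΣF n (λ i → sel (P i) (f i)) ∙ (f q ∙ f r)
      ≈⟨ ∙-cong ≃-refl (∙-cong (≃-sym (ΣF-δ n q f)) (≃-sym (ΣF-δ n r f))) ⟩
    ΣF n (λ i → sel (P i) (f i)) ∙ (ΣF n (λ i → sel (is q i) (f i)) ∙ ΣF n (λ i → sel (is r i) (f i)))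
      ≈⟨ ∙-cong ≃-refl (≃-sym (ΣF-∙ n _ _)) ⟩
    ΣF n (λ i → sel (P i) (f i)) ∙ ΣF n (λ i → sel (is q i) (f i) ∙ sel (is r i) (f i))
      ≈⟨ ∙-cong ≃-refl (ΣF-cong n λ i → ≃-sym (sel-∨ (is q i) (is r i) (f i) (q-r-disjoint i))) ⟩
    ΣF n (λ i → sel (P i) (f i)) ∙ ΣF n (λ i → sel (is q i ∨ is r i) (f i))
      ≈⟨ ≃-sym (ΣF-∙ n _ _) ⟩
    ΣF n (λ i → sel (P i) (f i) ∙ sel (is q i ∨ is r i) (f i))
      ≈⟨ ΣF-cong n (λ i → ≃-sym (sel-∨ (P i) (is q i ∨ is r i) (f i) (disjoint i))) ⟩
    ΣF n (λ i → sel (P i ∨ (is q i ∨ is r i)) (f i)) ∎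
    where
    is : Fin n → Fin n → Bool
    is p i = does (i ≟ p)
    q-r-disjoint : ∀ i → is q i ∧ is r i ≡ false
    q-r-disjoint i = does-exclusive (i ≟ q) (i ≟ r) (λ { ≡.refl ≡.refl → q≢r ≡.refl })

  member-sum : (c : U) (f : Fin (size c) → A) (ks : List (El c)) → Unique ks →
               ΣF (size c) (λ i → sel (does (member? c (dec c i) ks)) (f i)) ≃ fold (map (f ∘ enc c) ks)
  member-sum c f []       _            = ΣF-ε (size c)
  member-sum c f (k ∷ ks) (k∉ks ∷ uks) = begin
    ΣF (size c) (λ i → sel (is i k ∨ in? i) (f i))
      ≈⟨ ΣF-cong (size c) (λ i → sel-∨ (is i k) (in? i) (f i) (disjoint i)) ⟩
    ΣF (size c) (λ i → sel (is i k) (f i) ∙ sel (in? i) (f i))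
      ≈⟨ ΣF-∙ (size c) _ _ ⟩
    ΣF (size c) (λ i → sel (is i k) (f i)) ∙ ΣF (size c) (λ i → sel (in? i) (f i))
      ≈⟨ ∙-cong δ (member-sum c f ks uks) ⟩
    f (enc c k) ∙ fold (map (f ∘ enc c) ks) ∎
    where
    is : Fin (size c) → El c → Bool
    is i k = does (decEq c (dec c i) k)
    in? : Fin (size c) → Bool
    in? i = does (member? c (dec c i) ks)
    disjoint : ∀ i → is i k ∧ in? i ≡ false
    disjoint i = does-exclusive (decEq c (dec c i) k) (member? c (dec c i) ks)
                                (λ { ≡.refl k∈ks → All.lookup k∉ks k∈ks ≡.refl })
    δ : ΣF (size c) (λ i → sel (is i k) (f i)) ≃ f (enc c k)
    δ = ≃-trans
      (≃-reflexive (ΣF-cong-≗ (size c) (λ i → ≡.cong (λ j → sel (does (j ≟ enc c k)) (f i)) (enc-dec c i))))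
      (ΣF-δ (size c) (enc c k) f)

  fold-filter-member : (c : U) (f : Fin (size c) → A) (ks : List (El c)) → Unique ks →
    fold (map f (filterᵇ (λ i → does (member? c (dec c i) ks)) (allFin (size c)))) ≃ fold (map (f ∘ enc c) ks)
  fold-filter-member c f ks uks = ≃-trans (filter-sum (size c) (λ i → i) _ f) (member-sum c f ks uks)

module Handshake {a ℓ} (M : CommutativeMonoid a ℓ) (G : CubicGraph) where
  open CommutativeMonoid M
    renaming (Carrier to A; _≈_ to _≃_; refl to ≃-refl; sym to ≃-sym; trans to ≃-trans; reflexive to ≃-reflexive)
  open Sums M
  open import Relation.Binary.Reasoning.Setoid setoid

  private
    V E : ℕ
    V = nV G
    E = nE G

    at-one-position : ∀ {v e k₀} → inc G v k₀ ≡ e → (x : A) → ΣF 3 (λ k → sel (does (e ≟ inc G v k)) x) ≃ x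
    at-one-position {v} {e} {k₀} h x =
      ≃-trans (≃-reflexive (ΣF-cong-≗ 3 λ k → cong (λ b → sel b x) (position k))) (ΣF-δ 3 k₀ (λ _ → x))
      where
      position : ∀ k → does (e ≟ inc G v k) ≡ does (k ≟ k₀)
      position k = Dec.does-⇔ (mk⇔ (λ eq → inc-injective G v k k₀ (trans (sym eq) (sym h))) (λ { refl → sym h }))
                              (e ≟ inc G v k) (k ≟ k₀)

    at-no-position : ∀ {v e} → v ≢ src G e → v ≢ tgt G e → (x : A) → ΣF 3 (λ k → sel (does (e ≟ inc G v k)) x) ≃ ε
    at-no-position {v} {e} ¬s ¬t x = ≃-trans (≃-reflexive (ΣF-cong-≗ 3 λ k → cong (λ b → sel b x) (nowhere k))) (ΣF-ε 3)
      where
      nowhere : ∀ k → does (e ≟ inc G v k) ≡ false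
      nowhere k = Dec.dec-false (e ≟ inc G v k) λ { refl → Sum.[ ¬s ∘ sym , ¬t ∘ sym ] (inc-incident G v k) }

    incidences : ∀ v e (x : A) →
      ΣF 3 (λ k → sel (does (e ≟ inc G v k)) x) ≃ sel (does (v ≟ src G e)) x ∙ sel (does (v ≟ tgt G e)) x
    incidences v e x with v ≟ src G e | v ≟ tgt G e
    ... | yes s | yes t = ⊥-elim (loopless G e (trans (sym s) t))
    ... | yes s | no _  = ≃-trans (at-one-position (proj₂ (inc-complete G v e (inj₁ (sym s)))) x) (≃-sym (identityʳ x))
    ... | no _  | yes t = ≃-trans (at-one-position (proj₂ (inc-complete G v e (inj₂ (sym t)))) x) (≃-sym (identityˡ x))
    ... | no ¬s | no ¬t = ≃-trans (at-no-position ¬s ¬t x) (≃-sym (identityˡ ε))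

  handshake : (∀ x → x ∙ x ≃ ε) → (F : Fin E → A) → ΣF V (λ v → ΣF 3 (λ k → F (inc G v k))) ≃ ε
  handshake x∙x≃ε F = begin
    ΣF V (λ v → ΣF 3 (λ k → F (inc G v k)))
      ≈⟨ ΣF-cong V (λ v → ΣF-cong 3 (λ k → ≃-sym (ΣF-δ E (inc G v k) F))) ⟩
    ΣF V (λ v → ΣF 3 (λ k → ΣF E (λ e → incidence v k e)))
      ≈⟨ ΣF-cong V (λ v → ΣF-swap 3 E (incidence v)) ⟩
    ΣF V (λ v → ΣF E (λ e → ΣF 3 (λ k → incidence v k e)))
      ≈⟨ ΣF-swap V E (λ v e → ΣF 3 (λ k → incidence v k e)) ⟩
    ΣF E (λ e → ΣF V (λ v → ΣF 3 (λ k → incidence v k e)))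
      ≈⟨ ΣF-cong E (λ e → ΣF-cong V (λ v → incidences v e (F e))) ⟩
    ΣF E (λ e → ΣF V (λ v → sel (does (v ≟ src G e)) (F e) ∙ sel (does (v ≟ tgt G e)) (F e)))
      ≈⟨ ΣF-cong E (λ e → ≃-trans (ΣF-∙ V _ _) (∙-cong (ΣF-δ V (src G e) _) (ΣF-δ V (tgt G e) _))) ⟩
    ΣF E (λ e → F e ∙ F e)
      ≈⟨ ΣF-cong E (λ e → x∙x≃ε (F e)) ⟩
    ΣF E (λ _ → ε)
      ≈⟨ ΣF-ε E ⟩
    ε ∎
    where
    incidence : Fin V → Fin 3 → Fin E → A
    incidence v k e = sel (does (e ≟ inc G v k)) (F e)

module _ {Z : Set} (C : Circuit Z) where
  open Circuit C

  -- With fuel n, every gate whose index is below n gets its final value.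
  private
    valueWithFuel : ℕ → Fin gates → Poly Z
    valueWithFuel zero    g = cst false
    valueWithFuel (suc n) g = GateValue (label g) (map (valueWithFuel n) (children g))

    map-children-cong : (g : Fin gates) {f f′ : Fin gates → Poly Z} →
                        (∀ h → wire h g ≡ true → f h ≡ f′ h) → map f (children g) ≡ map f′ (children g)
    map-children-cong g {f} {f′} eq = go (allFin gates)
      where
      go : (xs : List (Fin gates)) → map f (filterᵇ (λ h → wire h g) xs) ≡ map f′ (filterᵇ (λ h → wire h g) xs)
      go []       = refl
      go (x ∷ xs) with wire x g in w
      ... | true  = cong₂ _∷_ (eq x w) (go xs)
      ... | false = go xs

    fuel-stable : (m n : ℕ) (g : Fin gates) → toℕ g < m → toℕ g < n → valueWithFuel m g ≡ valueWithFuel n g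
    fuel-stable (suc m) (suc n) g (s≤s g<m) (s≤s g<n) =
      cong (GateValue (label g)) (map-children-cong g λ h w →
        fuel-stable m n h (<-≤-trans (topological h g w) g<m) (<-≤-trans (topological h g w) g<n))

  evaluate : Evaluation C
  evaluate = (λ g → valueWithFuel (suc (toℕ g)) g) , λ g →
    cong (GateValue (label g)) (map-children-cong g λ h w →
      fuel-stable (toℕ g) (suc (toℕ h)) h (topological h g w) (n<1+n (toℕ h)))

module FromChildLists
  {Z : Set} (c : U) (label : El c → Gate Z) (kids : El c → List (El c))
  (kids-precede : ∀ g → All (λ h → Precedes c h g) (kids g))
  (kids-internal : ∀ g {h} → h ∈ kids g → IsInternal (label g))
  (output : El c) (reach : ∀ g → Star (λ h g → h ∈ kids g) g output)
  where

  wire : Fin (size c) → Fin (size c) → Bool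
  wire h g = does (member? c (dec c h) (kids (dec c g)))

  wire⇒kid : ∀ {h g} → wire h g ≡ true → dec c h ∈ kids (dec c g)
  wire⇒kid {h} {g} w with member? c (dec c h) (kids (dec c g))
  ... | yes p = p

  kid⇒wire : ∀ {h g} → h ∈ kids g → wire (enc c h) (enc c g) ≡ true
  kid⇒wire {h} {g} p rewrite dec-enc c h | dec-enc c g = Dec.dec-true (member? c h (kids g)) p

  circuit : Circuit Z
  circuit = record
    { gates  = size c
    ; label  = label ∘ dec c
    ; wire   = wire
    ; output = enc c output
    ; topological = λ h g w → subst₂ (λ i j → toℕ i < toℕ j) (enc-dec c h) (enc-dec c g)
        (Precedes⇒enc< c _ _ (All.lookup (kids-precede (dec c g)) (wire⇒kid w)))
    ; leaves-are-inputs = λ h g w → kids-internal (dec c g) (wire⇒kid w)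
    ; reaches-output = λ g → subst (λ i → Path wire i (enc c output)) (enc-dec c g) (path (reach (dec c g)))
    }
    where
    path : ∀ {g o} → Star (λ h g → h ∈ kids g) g o → Path wire (enc c g) (enc c o)
    path stop     = here
    path (p ◅ ps) = there (kid⇒wire p) (path ps)

  module Values (ev : Evaluation circuit) where
    open PolyRing Z using (≈-reflexive; +-commutativeMonoid; *-commutativeMonoid)
    private
      module Σ+ = Sums +-commutativeMonoid
      module Σ* = Sums *-commutativeMonoid

    value : El c → Poly Z
    value g = proj₁ ev (enc c g)

    private
      GateValue-cong : (l : Gate Z) {xs ys : List (Poly Z)} →
                       sumP xs ≈ sumP ys → prodP xs ≈ prodP ys → GateValue l xs ≈ GateValue l ys
      GateValue-cong (inp z)   _ _ = ≈-refl
      GateValue-cong (const b) _ _ = ≈-refl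
      GateValue-cong plus      s _ = s
      GateValue-cong times     _ p = p

    value-gate : ∀ g → Unique (kids g) → value g ≈ GateValue (label g) (map value (kids g))
    value-gate g uks = ≈-trans (≈-reflexive (trans (proj₂ ev (enc c g)) (cong children-value (dec-enc c g))))
      (GateValue-cong (label g) (Σ+.fold-filter-member c (proj₁ ev) (kids g) uks)
                                (Σ*.fold-filter-member c (proj₁ ev) (kids g) uks))
      where
      children-value : El c → Poly Z
      children-value a = GateValue (label a)
        (map (proj₁ ev) (filterᵇ (λ i → does (member? c (dec c i) (kids a))) (allFin (size c))))

  record Automorphism (act : Z → Z) : Set where
    field
      σ            : El c → El c
      σ-involutive : ∀ g → σ (σ g) ≡ g
      σ-label      : ∀ g → label (σ g) ≡ mapGate act (label g)
      σ-kids       : ∀ g → map σ (kids g) ⊆ kids (σ g)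

    private
      σ-kid : ∀ {h g} → h ∈ kids g → σ h ∈ kids (σ g)
      σ-kid {g = g} p = σ-kids g (∈-map⁺ σ p)

      σ-kid⁻ : ∀ {h g} → σ h ∈ kids (σ g) → h ∈ kids g
      σ-kid⁻ {h} {g} p = subst₂ _∈_ (σ-involutive h) (cong kids (σ-involutive g)) (σ-kid p)

    σ-wire : ∀ h g → wire (enc c (σ (dec c h))) (enc c (σ (dec c g))) ≡ wire h g
    σ-wire h g rewrite dec-enc c (σ (dec c h)) | dec-enc c (σ (dec c g)) =
      Dec.does-⇔ (mk⇔ σ-kid⁻ σ-kid) (member? c _ _) (member? c _ _)

  symmetric : {Grp : Set} {act : Grp → Z → Z} → (∀ π → Automorphism (act π)) → Symmetric Grp act circuit
  symmetric aut π = σ′ , σ′ , involutive , involutive , σ-wire ,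
    λ g → trans (cong label (dec-enc c _)) (σ-label (dec c g))
    where
    open Automorphism (aut π)
    σ′ : Fin (size c) → Fin (size c)
    σ′ i = enc c (σ (dec c i))
    involutive : ∀ i → σ′ (σ′ i) ≡ i
    involutive i = trans (cong (enc c ∘ σ) (dec-enc c _)) (trans (cong (enc c) (σ-involutive _)) (enc-dec c i))

-- Dual numbers a + b ε over F₂, with ε² = 0.
Dual : Set
Dual = Bool × Bool

infixl 6 _+ᴰ_
infixl 7 _*ᴰ_

_+ᴰ_ : Dual → Dual → Dual
(a , b) +ᴰ (c , d) = (a xor c , b xor d)

_*ᴰ_ : Dual → Dual → Dual
(a , b) *ᴰ (c , d) = (a ∧ c , (a ∧ d) xor (b ∧ c))

evalᴰ : {Z : Set} → (Z → Dual) → Poly Z → Dual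
evalᴰ ρ (var z) = ρ z
evalᴰ ρ (cst b) = (b , false)
evalᴰ ρ (p ⊕ q) = evalᴰ ρ p +ᴰ evalᴰ ρ q
evalᴰ ρ (p ⊗ q) = evalᴰ ρ p *ᴰ evalᴰ ρ q

module _ where
  open xor-∧-Solver

  +ᴰ-assoc : ∀ p q r → (p +ᴰ q) +ᴰ r ≡ p +ᴰ (q +ᴰ r)
  +ᴰ-assoc (a , b) (c , d) (e , f) = cong₂ _,_ (xor-assoc a c e) (xor-assoc b d f)

  +ᴰ-comm : ∀ p q → p +ᴰ q ≡ q +ᴰ p
  +ᴰ-comm (a , b) (c , d) = cong₂ _,_ (xor-comm a c) (xor-comm b d)

  +ᴰ-self : ∀ p → p +ᴰ p ≡ (false , false)
  +ᴰ-self (a , b) = cong₂ _,_ (xor-same a) (xor-same b)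

  *ᴰ-assoc : ∀ p q r → (p *ᴰ q) *ᴰ r ≡ p *ᴰ (q *ᴰ r)
  *ᴰ-assoc (a , b) (c , d) (e , f) = cong₂ _,_
    (solve 3 (λ a c e → (a :* c) :* e := a :* (c :* e)) refl a c e)
    (solve 6 (λ a b c d e f → ((a :* c) :* f) :+ (((a :* d) :+ (b :* c)) :* e)
                           := (a :* ((c :* f) :+ (d :* e))) :+ (b :* (c :* e))) refl a b c d e f)

  *ᴰ-comm : ∀ p q → p *ᴰ q ≡ q *ᴰ p
  *ᴰ-comm (a , b) (c , d) = cong₂ _,_ (∧-comm a c)
    (solve 4 (λ a b c d → (a :* d) :+ (b :* c) := (c :* b) :+ (d :* a)) refl a b c d)

  *ᴰ-identityˡ : ∀ p → (true , false) *ᴰ p ≡ p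
  *ᴰ-identityˡ (a , b) = cong (a ,_) (xor-identityʳ b)

  *ᴰ-distribˡ : ∀ p q r → p *ᴰ (q +ᴰ r) ≡ p *ᴰ q +ᴰ p *ᴰ r
  *ᴰ-distribˡ (a , b) (c , d) (e , f) = cong₂ _,_
    (solve 3 (λ a c e → a :* (c :+ e) := (a :* c) :+ (a :* e)) refl a c e)
    (solve 6 (λ a b c d e f → (a :* (d :+ f)) :+ (b :* (c :+ e))
                           := ((a :* d) :+ (b :* c)) :+ ((a :* f) :+ (b :* e))) refl a b c d e f)

evalᴰ-cong : {Z : Set} (ρ : Z → Dual) {p q : Poly Z} → p ≈ q → evalᴰ ρ p ≡ evalᴰ ρ q
evalᴰ-cong ρ ≈-refl          = refl
evalᴰ-cong ρ (≈-sym e)       = sym (evalᴰ-cong ρ e)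
evalᴰ-cong ρ (≈-trans e e′)  = trans (evalᴰ-cong ρ e) (evalᴰ-cong ρ e′)
evalᴰ-cong ρ (⊕-cong e e′)   = cong₂ _+ᴰ_ (evalᴰ-cong ρ e) (evalᴰ-cong ρ e′)
evalᴰ-cong ρ (⊗-cong e e′)   = cong₂ _*ᴰ_ (evalᴰ-cong ρ e) (evalᴰ-cong ρ e′)
evalᴰ-cong ρ (⊕-assoc p q r) = +ᴰ-assoc (evalᴰ ρ p) (evalᴰ ρ q) (evalᴰ ρ r)
evalᴰ-cong ρ (⊕-comm p q)    = +ᴰ-comm (evalᴰ ρ p) (evalᴰ ρ q)
evalᴰ-cong ρ (⊕-identity p)  = refl
evalᴰ-cong ρ (⊕-self p)      = +ᴰ-self (evalᴰ ρ p)
evalᴰ-cong ρ (⊗-assoc p q r) = *ᴰ-assoc (evalᴰ ρ p) (evalᴰ ρ q) (evalᴰ ρ r)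
evalᴰ-cong ρ (⊗-comm p q)    = *ᴰ-comm (evalᴰ ρ p) (evalᴰ ρ q)
evalᴰ-cong ρ (⊗-identity p)  = *ᴰ-identityˡ (evalᴰ ρ p)
evalᴰ-cong ρ (distrib p q r) = *ᴰ-distribˡ (evalᴰ ρ p) (evalᴰ ρ q) (evalᴰ ρ r)
evalᴰ-cong ρ (cst-⊕ a b)     = refl
evalᴰ-cong ρ (cst-⊗ a b)     = cong (a ∧ b ,_) (trans (xor-identityʳ _) (∧-zeroʳ a))

-- The line F₂ (1 + ε).
Balanced : Dual → Set
Balanced (a , b) = a ≡ b

module _ {X Y : Set} (ρ : Y → Bool) where

  onLine : X ⊎ Y → Dual
  onLine (inj₁ _) = (false , false)
  onLine (inj₂ y) = (ρ y , ρ y)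

  private
    pure : (g : Poly X) → proj₂ (evalᴰ onLine (substP (λ x → var (inj₁ x)) g)) ≡ false
    pure (var x) = refl
    pure (cst b) = refl
    pure (p ⊕ q) rewrite pure p | pure q = refl
    pure (p ⊗ q) with evalᴰ onLine (substP (λ x → var (inj₁ x)) p) | pure p
                    | evalᴰ onLine (substP (λ x → var (inj₁ x)) q) | pure q
    ... | a , .false | refl | c , .false | refl = trans (xor-identityʳ _) (∧-zeroʳ a)

    line-scaled : (b : Bool) (q : Dual) → proj₂ q ≡ false → Balanced ((b , b) *ᴰ q)
    line-scaled b (c , .false) refl = sym (cong (_xor (b ∧ c)) (∧-zeroʳ b))

    line-closed : (p q : Dual) → Balanced p → Balanced q → Balanced (p +ᴰ q)
    line-closed (a , .a) (c , .c) refl refl = refl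

  yLinear⇒balanced : (C : Poly (X ⊎ Y)) → yLinear C → Balanced (evalᴰ onLine C)
  yLinear⇒balanced C (L , C≈) = subst Balanced (sym (evalᴰ-cong onLine C≈)) (sum-balanced L)
    where
    sum-balanced : (L : List (Y × Poly X)) →
      Balanced (evalᴰ onLine (sumP (map (λ { (y , g) → var (inj₂ y) ⊗ substP (λ x → var (inj₁ x)) g }) L)))
    sum-balanced []            = refl
    sum-balanced ((y , g) ∷ L) = line-closed _ _ (line-scaled (ρ y) _ (pure g)) (sum-balanced L)

-- The certificate

-- Polynomial expressions written once over a ring signature (with constants κ), so that they can be
-- instantiated both at polynomials and at the syntax of the ring solver.
module Shapes {R : Set} (_+_ _*_ : R → R → R) (κ : Bool → R) where
  open RawSums _+_ (κ false) public using (ΣF; ΣU)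

  sum prod : List R → R
  sum  = foldr _+_ (κ false)
  prod = foldr _*_ (κ true)

  Σ₂ : (Bool → Bool → R) → R
  Σ₂ f = ΣU (uB u× uB) (λ (i , j) → f i j)

  shift : R → R
  shift y = sum (y ∷ κ true ∷ [])

  edgeSum : (Bool → R) → R
  edgeSum x = x false + x true

  edgeAxiom : (Bool → R) → R
  edgeAxiom x = edgeSum x + κ true

  vertexAxiom : (x₀ x₁ x₂ : Bool → R) → Bool → Bool → Bool → R
  vertexAxiom x₀ x₁ x₂ d i j = ((x₀ i + x₁ j) + x₂ (i xor j)) + κ (i xor j xor (i xor j) xor d)

  triple : (x₀ x₁ x₂ : Bool → R) → Bool → Bool → R
  triple x₀ x₁ x₂ i j = prod (x₀ i ∷ x₁ j ∷ x₂ (i xor j) ∷ [])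

  weighted : (x₀ x₁ x₂ : Bool → R) → R → Bool → Bool → R
  weighted x₀ x₁ x₂ m i j = prod (x₀ i ∷ x₁ j ∷ x₂ (i xor j) ∷ m ∷ [])

  mixed : (x₀ x₁ : Bool → R) → (Bool → Bool → R) → Bool → Bool → R
  mixed x₀ x₁ y i j = prod (x₀ i ∷ x₁ j ∷ y i j ∷ [])

  corner : R → R → Bool → R
  corner s₀ s₁ d = prod (s₀ ∷ s₁ ∷ sum (s₀ ∷ s₁ ∷ κ d ∷ []) ∷ [])

  vertexSum : (x₀ x₁ x₂ : Bool → R) → Bool → R
  vertexSum x₀ x₁ x₂ d = Σ₂ (triple x₀ x₁ x₂) +
    (Σ₂ (mixed x₀ x₁ (vertexAxiom x₀ x₁ x₂ d)) + corner (shift (edgeAxiom x₀)) (shift (edgeAxiom x₁)) d)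

  triangle : (x₀ x₁ x₂ : Bool → R) → R → R
  triangle x₀ x₁ x₂ m = (x₀ false * ((edgeSum x₁ * edgeSum x₂) * m)) +
    ((x₁ false * ((edgeSum x₀ * edgeSum x₂) * m)) + ((x₂ false * ((edgeSum x₀ * edgeSum x₁) * m)) + κ false))

module PolyIdentities (W : Set) where
  open PolyRing W
  open Shapes {Poly W} _⊕_ _⊗_ cst public
  private
    module Syntax n = Shapes {Solver.Polynomial n} Solver._:+_ Solver._:*_ Solver.con
    open Solver using (solve; _:=_; con)

    pick : {A : Set} → A → A → Bool → A
    pick a b false = a
    pick a b true  = b

  -- The local CFI identity at a vertex of charge d, once the axioms are substituted for the y's.
  vertex-identity : (x₀ x₁ x₂ : Bool → Poly W) (d : Bool) → vertexSum x₀ x₁ x₂ d ≈ cst false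
  vertex-identity x₀ x₁ x₂ false = solve 7 (λ a₀ a₁ b₀ b₁ c₀ c₁ _ →
    Syntax.vertexSum 7 (pick a₀ a₁) (pick b₀ b₁) (pick c₀ c₁) false := con false) ≈-refl
    (x₀ false) (x₀ true) (x₁ false) (x₁ true) (x₂ false) (x₂ true) (cst false)
  vertex-identity x₀ x₁ x₂ true = solve 7 (λ a₀ a₁ b₀ b₁ c₀ c₁ _ →
    Syntax.vertexSum 7 (pick a₀ a₁) (pick b₀ b₁) (pick c₀ c₁) true := con false) ≈-refl
    (x₀ false) (x₀ true) (x₁ false) (x₁ true) (x₂ false) (x₂ true) (cst false)

  triangle-identity : (x₀ x₁ x₂ : Bool → Poly W) (m : Poly W) →
                      Σ₂ (weighted x₀ x₁ x₂ m) ≈ triangle x₀ x₁ x₂ m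
  triangle-identity x₀ x₁ x₂ m = solve 7 (λ a₀ a₁ b₀ b₁ c₀ c₁ m →
    Syntax.Σ₂ 7 (Syntax.weighted 7 (pick a₀ a₁) (pick b₀ b₁) (pick c₀ c₁) m)
      := Syntax.triangle 7 (pick a₀ a₁) (pick b₀ b₁) (pick c₀ c₁) m) ≈-refl
    (x₀ false) (x₀ true) (x₁ false) (x₁ true) (x₂ false) (x₂ true) m

  shift-edgeAxiom : (x : Bool → Poly W) → shift (edgeAxiom x) ≈ edgeSum x
  shift-edgeAxiom x = solve 2 (λ a b → Syntax.shift 2 (Syntax.edgeAxiom 2 (pick a b)) := Syntax.edgeSum 2 (pick a b))
    ≈-refl (x false) (x true)

  corner-unit : (d : Bool) → corner (shift (cst false)) (shift (cst false)) d ≈ cst d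
  corner-unit false =
    solve 0 (Syntax.corner 0 (Syntax.shift 0 (con false)) (Syntax.shift 0 (con false)) false := con false) ≈-refl
  corner-unit true  =
    solve 0 (Syntax.corner 0 (Syntax.shift 0 (con false)) (Syntax.shift 0 (con false)) true := con true) ≈-refl

xor-cancelʳ : ∀ a b → (a xor b) xor b ≡ a
xor-cancelʳ a b = trans (xor-assoc a b b) (trans (cong (a xor_) (xor-same b)) (xor-identityʳ a))

complement-∨-others : ∀ a₀ a₁ a₂ → a₀ ∧ a₁ ≡ false → a₀ ∧ a₂ ≡ false → a₁ ∧ a₂ ≡ false →
  (not (a₀ ∨ a₁ ∨ a₂) ∨ (a₁ ∨ a₂) ≡ not a₀) × (not (a₀ ∨ a₁ ∨ a₂) ∨ (a₀ ∨ a₂) ≡ not a₁) ×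
  (not (a₀ ∨ a₁ ∨ a₂) ∨ (a₀ ∨ a₁) ≡ not a₂)
complement-∨-others false false false _ _ _ = refl , refl , refl
complement-∨-others true  false false _ _ _ = refl , refl , refl
complement-∨-others false true  false _ _ _ = refl , refl , refl
complement-∨-others false false true  _ _ _ = refl , refl , refl

complement-∧-others : ∀ a₀ a₁ a₂ →
  (not (a₀ ∨ a₁ ∨ a₂) ∧ (a₁ ∨ a₂) ≡ false) × (not (a₀ ∨ a₁ ∨ a₂) ∧ (a₀ ∨ a₂) ≡ false) ×
  (not (a₀ ∨ a₁ ∨ a₂) ∧ (a₀ ∨ a₁) ≡ false)
complement-∧-others true  _     _     = refl , refl , refl
complement-∧-others false true  _     = refl , refl , refl
complement-∧-others false false true  = refl , refl , refl
complement-∧-others false false false = refl , refl , refl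

module Certificate (G : CubicGraph) (u : Fin (nV G)) where

  V E : ℕ
  V = nV G
  E = nE G

  XY : Set
  XY = Var G ⊎ Ax G

  private
    module Z = Shapes {Poly XY} _⊕_ _⊗_ cst

  e₀ e₁ e₂ : Fin V → Fin E
  e₀ v = inc G v fzero
  e₁ v = inc G v (fsuc fzero)
  e₂ v = inc G v (fsuc (fsuc fzero))

  private
    inc-distinct : ∀ v k l → k ≢ l → inc G v k ≢ inc G v l
    inc-distinct v k l k≢l eq = k≢l (inc-injective G v k l eq)

  e₀≢e₁ : ∀ v → e₀ v ≢ e₁ v
  e₀≢e₁ v = inc-distinct v fzero (fsuc fzero) (λ ())

  e₀≢e₂ : ∀ v → e₀ v ≢ e₂ v
  e₀≢e₂ v = inc-distinct v fzero (fsuc (fsuc fzero)) (λ ())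

  e₁≢e₂ : ∀ v → e₁ v ≢ e₂ v
  e₁≢e₂ v = inc-distinct v (fsuc fzero) (fsuc (fsuc fzero)) (λ ())

  x : Fin E → Bool → Poly XY
  x e b = var (inj₁ (e , b))

  yE : Fin E → Poly XY
  yE e = var (inj₂ (eax e))

  yV : Fin V → Bool → Bool → Poly XY
  yV v i j = var (inj₂ (vax v i j (i xor j)))

  -- Written exactly as the constant of the axioms of v in CFI G u true, so that they match definitionally.
  charge : Fin V → Bool
  charge v = if does (v ≟ u) then true else false

  incident : Fin V → Fin E → Bool
  incident v e = does (e ≟ e₀ v) ∨ does (e ≟ e₁ v) ∨ does (e ≟ e₂ v)

  farEdges : Fin V → List (Fin E)
  farEdges v = filterᵇ (not ∘ incident v) (allFin E)

  far : Fin V → Poly XY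
  far v = Z.prod (map (Z.shift ∘ yE) (farEdges v))

  Triples : U
  Triples = uF V u× (uB u× uB)

  cubic : El Triples → Poly XY
  cubic (v , i , j) = Z.triple (x (e₀ v)) (x (e₁ v)) (x (e₂ v)) i j

  cubicFar : El Triples → Poly XY
  cubicFar (v , i , j) = Z.weighted (x (e₀ v)) (x (e₁ v)) (x (e₂ v)) (far v) i j

  mixedY : El Triples → Poly XY
  mixedY (v , i , j) = Z.mixed (x (e₀ v)) (x (e₁ v)) (yV v) i j

  cornerTerm : Fin V → Poly XY
  cornerTerm v = Z.corner (Z.shift (yE (e₀ v))) (Z.shift (yE (e₁ v))) (charge v)

  certificate : Poly XY
  certificate = cst true ⊕ (Z.ΣU Triples cubic ⊕ (Z.ΣU Triples cubicFar ⊕ (Z.ΣU Triples mixedY ⊕ Z.ΣF V cornerTerm)))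

  zeroY axY : XY → Poly (Var G)
  zeroY (inj₁ w) = var w
  zeroY (inj₂ a) = cst false
  axY (inj₁ w) = var w
  axY (inj₂ a) = CFI G u true a

  private
    open PolyRing (Var G)
    open PolyIdentities (Var G)
    module Σ+ = Sums +-commutativeMonoid
    module Σ* = Sums *-commutativeMonoid
    open import Relation.Binary.Reasoning.Setoid setoid

    X : Fin E → Bool → Poly (Var G)
    X e b = var (e , b)

    substP-ΣU : (σ : XY → Poly (Var G)) (c : U) (f : El c → Poly XY) → substP σ (Z.ΣU c f) ≡ ΣU c (substP σ ∘ f)
    substP-ΣU σ = ΣU-homo (substP σ) refl (λ _ _ → refl)

    substP-ΣF : (σ : XY → Poly (Var G)) (n : ℕ) (f : Fin n → Poly XY) → substP σ (Z.ΣF n f) ≡ ΣF n (substP σ ∘ f)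
    substP-ΣF σ = ΣF-homo (substP σ) refl (λ _ _ → refl)

    substP-far : (σ : XY → Poly (Var G)) (v : Fin V) → substP σ (far v) ≡ prod (map (substP σ ∘ Z.shift ∘ yE) (farEdges v))
    substP-far σ v = trans (fold-homo (substP σ) refl (λ _ _ → refl) (map (Z.shift ∘ yE) (farEdges v)))
                           (cong prod (sym (map-∘ (farEdges v))))

    substP-certificate : (σ : XY → Poly (Var G)) → substP σ certificate ≡
      cst true ⊕ (ΣU Triples (substP σ ∘ cubic) ⊕ (ΣU Triples (substP σ ∘ cubicFar) ⊕
        (ΣU Triples (substP σ ∘ mixedY) ⊕ ΣF V (substP σ ∘ cornerTerm))))
    substP-certificate σ = cong (cst true ⊕_) (cong₂ _⊕_ (substP-ΣU σ Triples cubic)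
      (cong₂ _⊕_ (substP-ΣU σ Triples cubicFar) (cong₂ _⊕_ (substP-ΣU σ Triples mixedY) (substP-ΣF σ V cornerTerm))))

    far₀ : ∀ v → substP zeroY (far v) ≈ cst true
    far₀ v = ≈-trans (≈-reflexive (substP-far zeroY v))
                     (Σ*.fold-map-ε (λ _ → ≈-trans (⊕-identity _) (⊕-identityʳ _)) (farEdges v))

    cubic-pair₀ : ∀ t → substP zeroY (cubic t) ⊕ substP zeroY (cubicFar t) ≈ cst false
    cubic-pair₀ (v , i , j) = ≈-trans (⊕-cong ≈-refl weight-one) (⊕-self _)
      where
      weight-one : weighted (X (e₀ v)) (X (e₁ v)) (X (e₂ v)) (substP zeroY (far v)) i j ≈
                   triple (X (e₀ v)) (X (e₁ v)) (X (e₂ v)) i j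
      weight-one = ⊗-cong ≈-refl (⊗-cong ≈-refl (⊗-cong ≈-refl
                     (≈-trans (⊗-cong (far₀ v) ≈-refl) (⊗-identity _))))

    mixed₀ : ∀ t → substP zeroY (mixedY t) ≈ cst false
    mixed₀ (v , i , j) = ≈-trans (⊗-cong ≈-refl (≈-trans (⊗-cong ≈-refl (⊗-zeroˡ _)) (⊗-zeroʳ _))) (⊗-zeroʳ _)

    corners₀ : Σ+.ΣF V (substP zeroY ∘ cornerTerm) ≈ cst true
    corners₀ = begin
      Σ+.ΣF V (substP zeroY ∘ cornerTerm)               ≈⟨ Σ+.ΣF-cong V (λ v → corner-unit (charge v)) ⟩
      Σ+.ΣF V (λ v → cst (charge v))                    ≡⟨ Σ+.ΣF-cong-≗ V charge-δ ⟩
      Σ+.ΣF V (λ v → Σ+.sel (does (v ≟ u)) (cst true)) ≈⟨ Σ+.ΣF-δ V u (λ _ → cst true) ⟩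
      cst true                                          ∎
      where
      charge-δ : ∀ v → cst (charge v) ≡ Σ+.sel (does (v ≟ u)) (cst true)
      charge-δ v with does (v ≟ u)
      ... | true  = refl
      ... | false = refl

  certificate-at-zero : substP zeroY certificate ≈ cst false
  certificate-at-zero = begin
    substP zeroY certificate
      ≡⟨ substP-certificate zeroY ⟩
    cst true ⊕ (ΣU Triples (substP zeroY ∘ cubic) ⊕ (ΣU Triples (substP zeroY ∘ cubicFar) ⊕
      (ΣU Triples (substP zeroY ∘ mixedY) ⊕ ΣF V (substP zeroY ∘ cornerTerm))))
      ≈⟨ ⊕-cong ≈-refl (≈-sym (⊕-assoc _ _ _)) ⟩
    cst true ⊕ ((ΣU Triples (substP zeroY ∘ cubic) ⊕ ΣU Triples (substP zeroY ∘ cubicFar)) ⊕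
      (ΣU Triples (substP zeroY ∘ mixedY) ⊕ ΣF V (substP zeroY ∘ cornerTerm)))
      ≈⟨ ⊕-cong ≈-refl (⊕-cong (≈-trans (≈-sym (Σ+.ΣU-∙ Triples (substP zeroY ∘ cubic) (substP zeroY ∘ cubicFar)))
                                         (≈-trans (Σ+.ΣU-cong Triples cubic-pair₀) (Σ+.ΣU-ε Triples)))
                                (⊕-cong (≈-trans (Σ+.ΣU-cong Triples mixed₀) (Σ+.ΣU-ε Triples)) corners₀)) ⟩
    cst true ⊕ (cst false ⊕ (cst false ⊕ cst true))
      ≈⟨ ⊕-cong ≈-refl (≈-trans (⊕-identity _) (⊕-identity _)) ⟩
    cst true ⊕ cst true
      ≈⟨ cst-⊕ true true ⟩
    cst false ∎

  private
    vertex-terms-vanish :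
      Σ+.ΣF V (λ v → Σ₂ (λ i j → substP axY (cubic (v , i , j)))) ⊕
        (Σ+.ΣF V (λ v → Σ₂ (λ i j → substP axY (mixedY (v , i , j)))) ⊕ Σ+.ΣF V (substP axY ∘ cornerTerm))
      ≈ cst false
    vertex-terms-vanish = begin
      _ ≈⟨ ⊕-cong ≈-refl (≈-sym (Σ+.ΣF-∙ V _ _)) ⟩
      _ ≈⟨ ≈-sym (Σ+.ΣF-∙ V _ _) ⟩
      Σ+.ΣF V (λ v → vertexSum (X (e₀ v)) (X (e₁ v)) (X (e₂ v)) (charge v))
        ≈⟨ Σ+.ΣF-cong V (λ v → vertex-identity (X (e₀ v)) (X (e₁ v)) (X (e₂ v)) (charge v)) ⟩
      Σ+.ΣF V (λ _ → cst false) ≈⟨ Σ+.ΣF-ε V ⟩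
      cst false ∎

    edgeSumsExcept : Fin E → Poly (Var G)
    edgeSumsExcept e = Σ*.ΣF E (λ e′ → Σ*.sel (not (does (e′ ≟ e))) (edgeSum (X e′)))

    far₁ : ∀ v → substP axY (far v) ≈ Σ*.ΣF E (λ e → Σ*.sel (not (incident v e)) (edgeSum (X e)))
    far₁ v = begin
      substP axY (far v)
        ≡⟨ substP-far axY v ⟩
      prod (map (λ e → shift (edgeAxiom (X e))) (farEdges v))
        ≈⟨ Σ*.fold-map-cong (λ e → shift-edgeAxiom (X e)) (farEdges v) ⟩
      prod (map (λ e → edgeSum (X e)) (farEdges v))
        ≈⟨ Σ*.filter-sum E (λ e → e) _ _ ⟩
      Σ*.ΣF E (λ e → Σ*.sel (not (incident v e)) (edgeSum (X e))) ∎

    far-completion : ∀ v (p q r : Fin E) → q ≢ r →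
      (∀ e → not (incident v e) ∨ (does (e ≟ q) ∨ does (e ≟ r)) ≡ not (does (e ≟ p))) →
      (∀ e → not (incident v e) ∧ (does (e ≟ q) ∨ does (e ≟ r)) ≡ false) →
      (edgeSum (X q) ⊗ edgeSum (X r)) ⊗ substP axY (far v) ≈ edgeSumsExcept p
    far-completion v p q r q≢r covers disjoint = begin
      (edgeSum (X q) ⊗ edgeSum (X r)) ⊗ substP axY (far v)
        ≈⟨ ≈-trans (⊗-comm _ _) (⊗-cong (far₁ v) ≈-refl) ⟩
      Σ*.ΣF E (λ e → Σ*.sel (not (incident v e)) (edgeSum (X e))) ⊗ (edgeSum (X q) ⊗ edgeSum (X r))
        ≈⟨ Σ*.ΣF-sel-pair E q r q≢r _ disjoint (λ e → edgeSum (X e)) ⟩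
      Σ*.ΣF E (λ e → Σ*.sel (not (incident v e) ∨ (does (e ≟ q) ∨ does (e ≟ r))) (edgeSum (X e)))
        ≡⟨ Σ*.ΣF-cong-≗ E (λ e → cong (λ b → Σ*.sel b (edgeSum (X e))) (covers e)) ⟩
      edgeSumsExcept p ∎

    dart : Fin E → Poly (Var G)
    dart e = X e false ⊗ edgeSumsExcept e

    cubicFar-darts : ∀ v → Σ₂ (λ i j → substP axY (cubicFar (v , i , j))) ≈ Σ+.ΣF 3 (λ k → dart (inc G v k))
    cubicFar-darts v = ≈-trans (triangle-identity (X (e₀ v)) (X (e₁ v)) (X (e₂ v)) (substP axY (far v)))
      (⊕-cong (⊗-cong ≈-refl (far-completion v (e₀ v) (e₁ v) (e₂ v) (e₁≢e₂ v)
                                (proj₁ ∘ covers) (proj₁ ∘ disjoint)))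
      (⊕-cong (⊗-cong ≈-refl (far-completion v (e₁ v) (e₀ v) (e₂ v) (e₀≢e₂ v)
                                (proj₁ ∘ proj₂ ∘ covers) (proj₁ ∘ proj₂ ∘ disjoint)))
      (⊕-cong (⊗-cong ≈-refl (far-completion v (e₂ v) (e₀ v) (e₁ v) (e₀≢e₁ v)
                                (proj₂ ∘ proj₂ ∘ covers) (proj₂ ∘ proj₂ ∘ disjoint)))
        ≈-refl)))
      where
      at : Fin E → Fin E → Bool
      at e p = does (e ≟ p)

      apart : ∀ {p q} → p ≢ q → ∀ e → at e p ∧ at e q ≡ false
      apart p≢q e = does-exclusive (e ≟ _) (e ≟ _) (λ { refl refl → p≢q refl })

      covers : ∀ e →
        (not (incident v e) ∨ (at e (e₁ v) ∨ at e (e₂ v)) ≡ not (at e (e₀ v))) ×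
        (not (incident v e) ∨ (at e (e₀ v) ∨ at e (e₂ v)) ≡ not (at e (e₁ v))) ×
        (not (incident v e) ∨ (at e (e₀ v) ∨ at e (e₁ v)) ≡ not (at e (e₂ v)))
      covers e = complement-∨-others (at e (e₀ v)) (at e (e₁ v)) (at e (e₂ v))
                   (apart (e₀≢e₁ v) e) (apart (e₀≢e₂ v) e) (apart (e₁≢e₂ v) e)

      disjoint : ∀ e →
        (not (incident v e) ∧ (at e (e₁ v) ∨ at e (e₂ v)) ≡ false) ×
        (not (incident v e) ∧ (at e (e₀ v) ∨ at e (e₂ v)) ≡ false) ×
        (not (incident v e) ∧ (at e (e₀ v) ∨ at e (e₁ v)) ≡ false)
      disjoint e = complement-∧-others (at e (e₀ v)) (at e (e₁ v)) (at e (e₂ v))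

    cubicFar-vanishes : Σ+.ΣF V (λ v → Σ₂ (λ i j → substP axY (cubicFar (v , i , j)))) ≈ cst false
    cubicFar-vanishes = ≈-trans (Σ+.ΣF-cong V cubicFar-darts) (Handshake.handshake +-commutativeMonoid G ⊕-self dart)

  certificate-at-axioms : substP axY certificate ≈ cst true
  certificate-at-axioms = begin
    substP axY certificate
      ≡⟨ substP-certificate axY ⟩
    cst true ⊕ (ΣU Triples (substP axY ∘ cubic) ⊕ (ΣU Triples (substP axY ∘ cubicFar) ⊕
      (ΣU Triples (substP axY ∘ mixedY) ⊕ ΣF V (substP axY ∘ cornerTerm))))
      ≈⟨ ⊕-cong ≈-refl (x∙yz≈y∙xz _ _ _) ⟩
    cst true ⊕ (ΣU Triples (substP axY ∘ cubicFar) ⊕ (ΣU Triples (substP axY ∘ cubic) ⊕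
      (ΣU Triples (substP axY ∘ mixedY) ⊕ ΣF V (substP axY ∘ cornerTerm))))
      ≈⟨ ⊕-cong ≈-refl (⊕-cong cubicFar-vanishes vertex-terms-vanish) ⟩
    cst true ⊕ (cst false ⊕ cst false)
      ≈⟨ ≈-trans (⊕-cong ≈-refl (⊕-identity _)) (⊕-identityʳ _) ⟩
    cst true ∎
    where
    open import Algebra.Properties.CommutativeSemigroup (CommutativeMonoid.commutativeSemigroup +-commutativeMonoid)
      using (x∙yz≈y∙xz)

  isEdgeAxiom : Ax G → Bool
  isEdgeAxiom (eax _) = true
  isEdgeAxiom _       = false

  -- At y_e = 1 + ε for the edge axioms (every other variable 0), each term of the sums contains
  -- a variable x or the square (y_e + 1)(y_e′ + 1) = ε², so only the constant 1 survives.
  certificate-at-line : evalᴰ (onLine isEdgeAxiom) certificate ≡ (true , false)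
  certificate-at-line = cong₂ (λ a b → (true , false) +ᴰ (a +ᴰ b)) (vanishes Triples cubic (λ _ → refl))
    (cong₂ _+ᴰ_ (vanishes Triples cubicFar (λ _ → refl))
      (cong₂ _+ᴰ_ (vanishes Triples mixedY (λ _ → refl)) (vanishes (uF V) cornerTerm (λ _ → refl))))
    where
    module D = RawSums _+ᴰ_ (false , false)
    vanishes : (c : U) (f : El c → Poly XY) → (∀ a → evalᴰ (onLine isEdgeAxiom) (f a) ≡ (false , false)) →
               evalᴰ (onLine isEdgeAxiom) (Z.ΣU c f) ≡ (false , false)
    vanishes c f pointwise = trans (ΣU-homo (evalᴰ (onLine isEdgeAxiom)) refl (λ _ _ → refl) c f)
                              (trans (D.ΣU-cong-≗ c pointwise) (D.ΣU-ε-≡ refl c))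

  certificate-not-yLinear : (C : Poly XY) → C ≈ certificate → ¬ yLinear C
  certificate-not-yLinear C C≈certificate lin
    with subst Balanced (trans (evalᴰ-cong (onLine isEdgeAxiom) C≈certificate) certificate-at-line)
               (yLinear⇒balanced isEdgeAxiom C lin)
  ... | ()

-- The circuit

sizeBound : NatPoly
sizeBound = 4 ∷ 3 ∷ []

module CFICircuit (G : CubicGraph) (u : Fin (nV G)) where
  open Certificate G u

  Below Top Gates : U
  Below = ((uF E u× uB) u+ (Triples u+ (uF E u+ uB))) u+ (uF E u+ (uF V u+ uF V))
  Top   = Triples u+ (Triples u+ (Triples u+ (uF V u+ u1)))
  Gates = Below u+ (Top u+ u1)

  pattern gX e b         = inj₁ (inj₁ (inj₁ (e , b)))
  pattern gYV v i j      = inj₁ (inj₁ (inj₂ (inj₁ (v , i , j))))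
  pattern gYE e          = inj₁ (inj₁ (inj₂ (inj₂ (inj₁ e))))
  pattern gK b           = inj₁ (inj₁ (inj₂ (inj₂ (inj₂ b))))
  pattern gShift e       = inj₁ (inj₂ (inj₁ e))
  pattern gFar v         = inj₁ (inj₂ (inj₂ (inj₁ v)))
  pattern gCornerSum v   = inj₁ (inj₂ (inj₂ (inj₂ v)))
  pattern gCubic v i j   = inj₂ (inj₁ (inj₁ (v , i , j)))
  pattern gCubicFar v i j = inj₂ (inj₁ (inj₂ (inj₁ (v , i , j))))
  pattern gMixed v i j   = inj₂ (inj₁ (inj₂ (inj₂ (inj₁ (v , i , j)))))
  pattern gCorner v      = inj₂ (inj₁ (inj₂ (inj₂ (inj₂ (inj₁ v)))))
  pattern gZero          = inj₂ (inj₁ (inj₂ (inj₂ (inj₂ (inj₂ tt)))))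
  pattern gOut           = inj₂ (inj₂ tt)

  label : El Gates → Gate XY
  label (gX e b)          = inp (inj₁ (e , b))
  label (gYV v i j)       = inp (inj₂ (vax v i j (i xor j)))
  label (gYE e)           = inp (inj₂ (eax e))
  label (gK b)            = const b
  label (gShift e)        = plus
  label (gFar v)          = times
  label (gCornerSum v)    = plus
  label (gCubic v i j)    = times
  label (gCubicFar v i j) = times
  label (gMixed v i j)    = times
  label (gCorner v)       = times
  label gZero             = times
  label gOut              = plus

  top : El Top → El Gates
  top t = inj₂ (inj₁ t)

  -- gZero multiplies the constant 0 with all gates below the top layer, so that they reach the output.
  kids : El Gates → List (El Gates)
  kids (inj₁ (inj₁ _))    = []
  kids (gShift e)         = gYE e ∷ gK true ∷ []
  kids (gFar v)           = map (λ e → gShift e) (farEdges v)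
  kids (gCornerSum v)     = gShift (e₀ v) ∷ gShift (e₁ v) ∷ gK (charge v) ∷ []
  kids (gCubic v i j)     = gX (e₀ v) i ∷ gX (e₁ v) j ∷ gX (e₂ v) (i xor j) ∷ []
  kids (gCubicFar v i j)  = gX (e₀ v) i ∷ gX (e₁ v) j ∷ gX (e₂ v) (i xor j) ∷ gFar v ∷ []
  kids (gMixed v i j)     = gX (e₀ v) i ∷ gX (e₁ v) j ∷ gYV v i j ∷ []
  kids (gCorner v)        = gShift (e₀ v) ∷ gShift (e₁ v) ∷ gCornerSum v ∷ []
  kids gZero              = map inj₁ (elements Below)
  kids gOut               = gK true ∷ map top (elements Top)

  kids-precede : ∀ g → All (λ h → Precedes Gates h g) (kids g)
  kids-precede (inj₁ (inj₁ _))   = []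
  kids-precede (gShift e)        = tt ∷ tt ∷ []
  kids-precede (gFar v)          = All.map⁺ (All.universal (λ _ → tt) (farEdges v))
  kids-precede (gCornerSum v)    = tt ∷ tt ∷ tt ∷ []
  kids-precede (gCubic v i j)    = tt ∷ tt ∷ tt ∷ []
  kids-precede (gCubicFar v i j) = tt ∷ tt ∷ tt ∷ tt ∷ []
  kids-precede (gMixed v i j)    = tt ∷ tt ∷ tt ∷ []
  kids-precede (gCorner v)       = tt ∷ tt ∷ tt ∷ []
  kids-precede gZero             = All.map⁺ (All.universal (λ _ → tt) (elements Below))
  kids-precede gOut              = tt ∷ All.map⁺ (All.universal (λ _ → tt) (elements Top))

  kids-internal : ∀ g {h} → h ∈ kids g → IsInternal (label g)
  kids-internal (inj₁ (inj₁ _))   ()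
  kids-internal (gShift e)        _ = refl
  kids-internal (gFar v)          _ = refl
  kids-internal (gCornerSum v)    _ = refl
  kids-internal (gCubic v i j)    _ = refl
  kids-internal (gCubicFar v i j) _ = refl
  kids-internal (gMixed v i j)    _ = refl
  kids-internal (gCorner v)       _ = refl
  kids-internal gZero             _ = refl
  kids-internal gOut              _ = refl

  reach : ∀ g → Star (λ h g → h ∈ kids g) g gOut
  reach (inj₁ b)        = ∈-map⁺ inj₁ (elements-complete Below b) ◅ reach gZero
  reach (inj₂ (inj₁ t)) = there (∈-map⁺ top (elements-complete Top t)) ◅ stop
  reach gOut            = stop

  private
    gX-edge : {e e′ : Fin E} {b b′ : Bool} → _≡_ {A = El Gates} (gX e b) (gX e′ b′) → e ≡ e′
    gX-edge refl = refl

    gShift-edge : {e e′ : Fin E} → _≡_ {A = El Gates} (gShift e) (gShift e′) → e ≡ e′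
    gShift-edge refl = refl


  kids-unique : ∀ g → Unique (kids g)
  kids-unique (inj₁ (inj₁ _))   = []
  kids-unique (gShift e)        = ((λ ()) ∷ []) ∷ [] ∷ []
  kids-unique (gFar v)          = map⁺ gShift-edge (filter⁺ (T? ∘ (not ∘ incident v)) (allFin⁺ E))
  kids-unique (gCornerSum v)    = (e₀≢e₁ v ∘ gShift-edge ∷ (λ ()) ∷ []) ∷ ((λ ()) ∷ []) ∷ [] ∷ []
  kids-unique (gCubic v i j)    = (e₀≢e₁ v ∘ gX-edge ∷ e₀≢e₂ v ∘ gX-edge ∷ [])
                                ∷ (e₁≢e₂ v ∘ gX-edge ∷ []) ∷ [] ∷ []
  kids-unique (gCubicFar v i j) = (e₀≢e₁ v ∘ gX-edge ∷ e₀≢e₂ v ∘ gX-edge ∷ (λ ()) ∷ [])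
                                ∷ (e₁≢e₂ v ∘ gX-edge ∷ (λ ()) ∷ []) ∷ ((λ ()) ∷ []) ∷ [] ∷ []
  kids-unique (gMixed v i j)    = (e₀≢e₁ v ∘ gX-edge ∷ (λ ()) ∷ []) ∷ ((λ ()) ∷ []) ∷ [] ∷ []
  kids-unique (gCorner v)       = (e₀≢e₁ v ∘ gShift-edge ∷ (λ ()) ∷ []) ∷ ((λ ()) ∷ []) ∷ [] ∷ []
  kids-unique gZero             = map⁺ (λ { refl → refl }) (elements-unique Below)
  kids-unique gOut              = All.map⁺ (All.universal (λ _ ()) (elements Top))
                                ∷ map⁺ (λ { refl → refl }) (elements-unique Top)

  open FromChildLists Gates label kids kids-precede kids-internal gOut reach

  module Flip (π : EdgeFlip G) where
    private
      f : Fin E → Bool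
      f = proj₁ π

    flipTriple : El Triples → El Triples
    flipTriple (v , i , j) = v , i xor f (e₀ v) , j xor f (e₁ v)

    σBelow : El Below → El Below
    σBelow (inj₁ (inj₁ (e , b)))      = inj₁ (inj₁ (e , b xor f e))
    σBelow (inj₁ (inj₂ (inj₁ t)))     = inj₁ (inj₂ (inj₁ (flipTriple t)))
    σBelow b                          = b

    σTop : El Top → El Top
    σTop (inj₁ t)                     = inj₁ (flipTriple t)
    σTop (inj₂ (inj₁ t))              = inj₂ (inj₁ (flipTriple t))
    σTop (inj₂ (inj₂ (inj₁ t)))       = inj₂ (inj₂ (inj₁ (flipTriple t)))
    σTop t                            = t

    σ : El Gates → El Gates
    σ (inj₁ b)        = inj₁ (σBelow b)
    σ (inj₂ (inj₁ t)) = top (σTop t)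
    σ gOut            = gOut

    -- The flips at the three edges of a vertex add up to 0.
    parity : ∀ v i j → (i xor f (e₀ v)) xor (j xor f (e₁ v)) ≡ (i xor j) xor f (e₂ v)
    parity v i j = begin
      (i xor a) xor (j xor b)
        ≡⟨ solve 5 (λ i j a b c → (i :+ a) :+ (j :+ b) := (i :+ j) :+ (c :+ (a :+ (b :+ c)))) refl i j a b c ⟩
      (i xor j) xor (c xor (a xor (b xor c)))  ≡⟨ cong (λ z → (i xor j) xor (c xor z)) (proj₂ π v) ⟩
      (i xor j) xor (c xor false)              ≡⟨ cong ((i xor j) xor_) (xor-identityʳ c) ⟩
      (i xor j) xor c                          ∎
      where
      open ≡.≡-Reasoning
      open xor-∧-Solver
      a = f (e₀ v)
      b = f (e₁ v)
      c = f (e₂ v)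

    flipTriple-involutive : ∀ t → flipTriple (flipTriple t) ≡ t
    flipTriple-involutive (v , i , j) = cong₂ (λ i′ j′ → v , i′ , j′) (xor-cancelʳ i _) (xor-cancelʳ j _)

    σ-involutive : ∀ g → σ (σ g) ≡ g
    σ-involutive (gX e b)                              = cong (λ b′ → gX e b′) (xor-cancelʳ b (f e))
    σ-involutive (inj₁ (inj₁ (inj₂ (inj₁ t))))          =
      cong (λ t′ → inj₁ (inj₁ (inj₂ (inj₁ t′)))) (flipTriple-involutive t)
    σ-involutive (inj₁ (inj₁ (inj₂ (inj₂ _))))          = refl
    σ-involutive (inj₁ (inj₂ _))                        = refl
    σ-involutive (inj₂ (inj₁ (inj₁ t)))                 = cong (λ t′ → top (inj₁ t′)) (flipTriple-involutive t)
    σ-involutive (inj₂ (inj₁ (inj₂ (inj₁ t))))          =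
      cong (λ t′ → top (inj₂ (inj₁ t′))) (flipTriple-involutive t)
    σ-involutive (inj₂ (inj₁ (inj₂ (inj₂ (inj₁ t)))))   =
      cong (λ t′ → top (inj₂ (inj₂ (inj₁ t′)))) (flipTriple-involutive t)
    σ-involutive (inj₂ (inj₁ (inj₂ (inj₂ (inj₂ _)))))   = refl
    σ-involutive gOut                                   = refl

    σ-label : ∀ g → label (σ g) ≡ mapGate (actXY G π) (label g)
    σ-label (gX e b)          = refl
    σ-label (gYV v i j)       = cong (λ k → inp (inj₂ (vax v _ _ k))) (parity v i j)
    σ-label (gYE e)           = refl
    σ-label (gK b)            = refl
    σ-label (gShift e)        = refl
    σ-label (gFar v)          = refl
    σ-label (gCornerSum v)    = refl
    σ-label (gCubic v i j)    = refl
    σ-label (gCubicFar v i j) = refl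
    σ-label (gMixed v i j)    = refl
    σ-label (gCorner v)       = refl
    σ-label gZero             = refl
    σ-label gOut              = refl

    σ-kids : ∀ g → map σ (kids g) ⊆ kids (σ g)
    σ-kids (inj₁ (inj₁ _))   ()
    σ-kids (gShift e)        p = p
    σ-kids (gFar v)          = ⊆-reflexive (sym (map-∘ (farEdges v)))
    σ-kids (gCornerSum v)    p = p
    σ-kids (gCubic v i j)    = ⊆-reflexive (cong (λ k → _ ∷ _ ∷ gX (e₂ v) k ∷ []) (sym (parity v i j)))
    σ-kids (gCubicFar v i j) = ⊆-reflexive (cong (λ k → _ ∷ _ ∷ gX (e₂ v) k ∷ gFar v ∷ []) (sym (parity v i j)))
    σ-kids (gMixed v i j)    p = p
    σ-kids (gCorner v)       p = p
    σ-kids gZero             = image-closed Below inj₁ σ σBelow (λ _ → refl)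
    σ-kids gOut (here p)     = here p
    σ-kids gOut (there p)    = there (image-closed Top top σ σTop (λ _ → refl) p)

    automorphism : Automorphism (actXY G π)
    automorphism = record { σ = σ ; σ-involutive = σ-involutive ; σ-label = σ-label ; σ-kids = σ-kids }

  module GateValues (ev : Evaluation circuit) where
    open Values ev
    open PolyRing XY using (≈-reflexive; ⊕-identityʳ; prodP-absorb; +-commutativeMonoid; *-commutativeMonoid)
    private
      module Σ+ = Sums +-commutativeMonoid
      module Σ* = Sums *-commutativeMonoid
      module Z = Shapes {Poly XY} _⊕_ _⊗_ cst

      value-x : ∀ e b → value (gX e b) ≈ x e b
      value-x e b = value-gate (gX e b) []

      value-yV : ∀ v i j → value (gYV v i j) ≈ yV v i j
      value-yV v i j = value-gate (gYV v i j) []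

      value-yE : ∀ e → value (gYE e) ≈ yE e
      value-yE e = value-gate (gYE e) []

      value-K : ∀ b → value (gK b) ≈ cst b
      value-K b = value-gate (gK b) []

      value-shift : ∀ e → value (gShift e) ≈ Z.shift (yE e)
      value-shift e = ≈-trans (value-gate (gShift e) (kids-unique (gShift e)))
        (⊕-cong (value-yE e) (⊕-cong (value-K true) ≈-refl))

      value-far : ∀ v → value (gFar v) ≈ far v
      value-far v = ≈-trans (value-gate (gFar v) (kids-unique (gFar v)))
        (≈-trans (≈-reflexive (cong prodP (sym (map-∘ (farEdges v))))) (Σ*.fold-map-cong value-shift (farEdges v)))

      value-cornerSum : ∀ v →
        value (gCornerSum v) ≈ Z.sum (Z.shift (yE (e₀ v)) ∷ Z.shift (yE (e₁ v)) ∷ cst (charge v) ∷ [])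
      value-cornerSum v = ≈-trans (value-gate (gCornerSum v) (kids-unique (gCornerSum v)))
        (⊕-cong (value-shift _) (⊕-cong (value-shift _) (⊕-cong (value-K _) ≈-refl)))

      value-corner : ∀ v → value (gCorner v) ≈ cornerTerm v
      value-corner v = ≈-trans (value-gate (gCorner v) (kids-unique (gCorner v)))
        (⊗-cong (value-shift _) (⊗-cong (value-shift _) (⊗-cong (value-cornerSum v) ≈-refl)))

      value-cubic : ∀ t → value (top (inj₁ t)) ≈ cubic t
      value-cubic (v , i , j) = ≈-trans (value-gate (gCubic v i j) (kids-unique (gCubic v i j)))
        (⊗-cong (value-x _ _) (⊗-cong (value-x _ _) (⊗-cong (value-x _ _) ≈-refl)))

      value-cubicFar : ∀ t → value (top (inj₂ (inj₁ t))) ≈ cubicFar t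
      value-cubicFar (v , i , j) = ≈-trans (value-gate (gCubicFar v i j) (kids-unique (gCubicFar v i j)))
        (⊗-cong (value-x _ _) (⊗-cong (value-x _ _) (⊗-cong (value-x _ _) (⊗-cong (value-far v) ≈-refl))))

      value-mixed : ∀ t → value (top (inj₂ (inj₂ (inj₁ t)))) ≈ mixedY t
      value-mixed (v , i , j) = ≈-trans (value-gate (gMixed v i j) (kids-unique (gMixed v i j)))
        (⊗-cong (value-x _ _) (⊗-cong (value-x _ _) (⊗-cong (value-yV v i j) ≈-refl)))

      value-zero : value gZero ≈ cst false
      value-zero = ≈-trans (value-gate gZero (kids-unique gZero))
        (prodP-absorb (∈-map⁺ inj₁ (elements-complete Below (inj₁ (inj₂ (inj₂ (inj₂ false)))))) (value-K false))

    value-out : value gOut ≈ certificate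
    value-out = ≈-trans (value-gate gOut (kids-unique gOut))
      (⊕-cong (value-K true)
        (≈-trans (≈-reflexive (cong sumP (sym (map-∘ (elements Top)))))
        (≈-trans (Σ+.fold-elements Top (value ∘ top))
          (⊕-cong (Σ+.ΣU-cong Triples value-cubic) (⊕-cong (Σ+.ΣU-cong Triples value-cubicFar)
            (⊕-cong (Σ+.ΣU-cong Triples value-mixed)
              (≈-trans (⊕-cong (Σ+.ΣF-cong V value-corner) value-zero) (⊕-identityʳ _))))))))

  refutation : SymIPSRefutation G u true
  refutation = record
    { circuit     = circuit
    ; evaluation  = evaluate circuit
    ; certificate =
        ≈-trans (≈-reflexive (substP-ext {τ = zeroY} (λ { (inj₁ _) → refl ; (inj₂ _) → refl }) (value gOut)))
                (≈-trans (substP-cong zeroY value-out) certificate-at-zero) ,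
        ≈-trans (≈-reflexive (substP-ext {τ = axY} (λ { (inj₁ _) → refl ; (inj₂ _) → refl }) (value gOut)))
                (≈-trans (substP-cong axY value-out) certificate-at-axioms)
    ; symmetric   = symmetric (λ π → Flip.automorphism π)
    }
    where
    open Values (evaluate circuit) using (value)
    open GateValues (evaluate circuit) using (value-out)
    open PolyRing (Var G) using (≈-reflexive)

  refutation-not-yLinear : ¬ SymIPSRefutation.isYLinear refutation
  refutation-not-yLinear = certificate-not-yLinear _ (GateValues.value-out (evaluate circuit))

  gates-count : size Gates + (5 * V + 11 * E) ≡ evalNatPoly sizeBound (cfiSize G)
  gates-count = solve 2 (λ V E →
    let fourV = V :* (con 2 :* con 2)
        n     = con 8 :* V :+ E :+ con 2 :* E :+ con 2 :* E
    in (((E :* con 2 :+ (fourV :+ (E :+ con 2))) :+ (E :+ (V :+ V)))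
         :+ ((fourV :+ (fourV :+ (fourV :+ (V :+ con 1)))) :+ con 1))
       :+ (con 5 :* V :+ con 11 :* E)
       := con 4 :+ n :* (con 3 :+ n :* con 0))
    refl V E
    where open +-*-Solver

  variables-count : (numVars G + numAxioms G) + (4 + 16 * V + 10 * E) ≡ evalNatPoly sizeBound (cfiSize G)
  variables-count = solve 2 (λ V E →
    let n = con 8 :* V :+ E :+ con 2 :* E :+ con 2 :* E
    in (con 2 :* E :+ (con 8 :* V :+ E :+ con 2 :* E)) :+ (con 4 :+ con 16 :* V :+ con 10 :* E)
       := con 4 :+ n :* (con 3 :+ n :* con 0))
    refl V E
    where open +-*-Solver

  size-bound : SymIPSRefutation.size refutation ≤ evalNatPoly sizeBound (cfiSize G)
  size-bound = ⊔-lub (subst (size Gates ≤_) gates-count (m≤m+n _ _))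
                     (subst (numVars G + numAxioms G ≤_) variables-count (m≤m+n _ _))

theorem6p2 : (G : ℕ → CubicGraph) → (∀ n → Connected (G n)) →
    Σ[ p ∈ NatPoly ] (∀ (n : ℕ) (u : Fin (nV (G n))) →
      Σ[ R ∈ SymIPSRefutation (G n) u true ]
        (¬ SymIPSRefutation.isYLinear R)
        × (SymIPSRefutation.size R ≤ evalNatPoly p (cfiSize (G n))))
theorem6p2 G _ = sizeBound , λ n u →
  refutation (G n) u , refutation-not-yLinear (G n) u , size-bound (G n) u
  where open CFICircuit
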